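{- For an odd integer $k\ge 3$, let $\mathcal{R}_k$ be the graph obtained as follows: take a cycle $C_k=v_0v_1\cdots v_{k-1}v_0$ and $k$ disjoint $4$-cycles $D_0,\dots,D_{k-1}$, and for each $i\in\{0,\dots,k-1\}$ identify one edge of $D_i$ with the edge $v_iv_{i+1}$ of $C_k$ (indices modulo $k$). For an integer $d\ge 1$, let $\mathcal{L}_d$ be the graph obtained from a path $v_0v_1\cdots v_{2d}$ on $2d+1$ vertices by adding the edges $v_iv_{2d-i}$ for every $i\in\{0,\dots,d-1\}$. Then: (1) $c_o(\mathcal{R}_k)/c_e(\mathcal{R}_k)\to\infty$ as $k\to\infty$ (over odd $k$); (2) $c_e(\mathcal{L}_m)/c_o(\mathcal{L}_m)\to\infty$ as $m\to\infty$.
   Context: All graphs are finite, simple and undirected. For a graph $G$, $c_o(G)$ (resp. $c_e(G)$) denotes the number of distinct cycles of odd (resp. even) length in $G$, where two subgraphs are distinct if their vertex sets or edge sets differ. -}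

module Defs where

open import Data.Nat using (ℕ; zero; suc; _+_; _*_; _∸_; _%_)
import Data.Nat as ℕ
open import Data.Bool using (Bool; true; false; _∨_)
open import Data.Fin using (Fin; zero; suc; toℕ; lower₁; remQuot; splitAt)
import Data.Fin.Properties as FinP
open import Data.Fin.Subset using (Subset; _∈_; _∩_; ∣_∣; Nonempty)
open import Data.Vec using (tabulate)
open import Data.Product using (Σ; ∃; ∃-syntax; _×_; _,_)
open import Data.Product.Properties using (≡-dec)
open import Data.Sum using (_⊎_; inj₁; inj₂)
open import Data.List using (List; length)
import Data.List.Membership.Propositional as LM
open import Data.List.Relation.Unary.Unique.Propositional using (Unique)
open import Relation.Nullary using (yes; no)
open import Relation.Nullary.Decidable using (⌊_⌋)
open import Relation.Binary.Definitions using (DecidableEquality)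
open import Relation.Binary.PropositionalEquality using (_≡_)
open import Relation.Binary.Construct.Closure.ReflexiveTransitive using (Star)
open import Function.Bundles using (_⇔_)

-- Isolated vertices
-- play no role in cycle counting, so only edges are recorded.

record Graph : Set₁ where
  field
    V     : Set
    _≟V_  : DecidableEquality V
    m     : ℕ
    edge  : Fin m → V × V

module _ (G : Graph) where
  open Graph G

  EdgeSet : Set
  EdgeSet = Subset m

  incident : V → Fin m → Bool
  incident v e with edge e
  ... | (x , y) = ⌊ v ≟V x ⌋ ∨ ⌊ v ≟V y ⌋

  deg : EdgeSet → V → ℕ
  deg F v = ∣ F ∩ tabulate (incident v) ∣

  Step : EdgeSet → Fin m → Fin m → Set
  Step F e f = e ∈ F × f ∈ F × ∃[ v ] (incident v e ≡ true × incident v f ≡ true)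

  Connected : EdgeSet → Set
  Connected F = ∀ e f → e ∈ F → f ∈ F → Star (Step F) e f

  -- F is the edge set of a cycle of G: nonempty, connected, 2-regular
  -- (every vertex has degree 0 or 2 in F).  Its length is ∣ F ∣.
  IsCycle : EdgeSet → Set
  IsCycle F = Nonempty F × (∀ v → deg F v ≡ 0 ⊎ deg F v ≡ 2) × Connected F

  OddCycle : EdgeSet → Set
  OddCycle F = IsCycle F × ∣ F ∣ % 2 ≡ 1

  EvenCycle : EdgeSet → Set
  EvenCycle F = IsCycle F × ∣ F ∣ % 2 ≡ 0

  HasCount : (EdgeSet → Set) → ℕ → Set
  HasCount P N = Σ (List EdgeSet) λ L →
    Unique L × (∀ F → (F LM.∈ L) ⇔ P F) × length L ≡ N

  c-odd≡ : ℕ → Set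
  c-odd≡ = HasCount OddCycle

  c-even≡ : ℕ → Set
  c-even≡ = HasCount EvenCycle

next : ∀ {k} → Fin k → Fin k
next {suc n} i with n ℕ.≟ toℕ i
... | yes _ = zero
... | no ne = suc (lower₁ i ne)

-- R_k : vertices (i , 0) = v_i, (i , 1) = a_i, (i , 2) = b_i;
-- D_i is the 4-cycle v_i v_{i+1} b_i a_i v_i, sharing edge v_i v_{i+1}.
R : ℕ → Graph
R k = record
  { V = Fin k × Fin 3
  ; _≟V_ = ≡-dec FinP._≟_ FinP._≟_
  ; m = k * 4
  ; edge = λ e → edgeR (remQuot 4 e)
  }
  where
  edgeR : Fin k × Fin 4 → (Fin k × Fin 3) × (Fin k × Fin 3)
  edgeR (i , zero)                   = (i , zero) , (next i , zero)
  edgeR (i , suc zero)               = (next i , zero) , (i , suc (suc zero))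
  edgeR (i , suc (suc zero))         = (i , suc (suc zero)) , (i , suc zero)
  edgeR (i , suc (suc (suc zero)))   = (i , suc zero) , (i , zero)

-- L_d : vertices v_j encoded as j ∈ ℕ (0 ≤ j ≤ 2d); path edges v_j v_{j+1}
-- (j < 2d) and chords v_i v_{2d-i} (i < d).
L : ℕ → Graph
L d = record
  { V = ℕ
  ; _≟V_ = ℕ._≟_
  ; m = 2 * d + d
  ; edge = λ e → edgeL (splitAt (2 * d) e)
  }
  where
  edgeL : Fin (2 * d) ⊎ Fin d → ℕ × ℕ
  edgeL (inj₁ j) = toℕ j , suc (toℕ j)
  edgeL (inj₂ i) = toℕ i , 2 * d ∸ toℕ i

{-# OPTIONS --safe #-}
-- In R_k, a cycle either is one of the squares D_i or runs once around the ring, taking in each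
-- D_i either the edge v_i v_{i+1} or the detour v_{i+1} b_i a_i v_i: degrees 0 or 2 at a_i and
-- b_i make each detour all-or-nothing, and a cycle using both v_i v_{i+1} and a_i v_i contains, hence
-- equals, D_i. A rim has length k + 2·(number of detours), which is odd, so c_o(R_k) = 2^k and
-- c_e(R_k) = k.
--
-- In L_d, the chords v_i v_{2d-i} are the rungs of a ladder whose two rails v_0 … v_d and
-- v_{2d} … v_d meet at v_d. A cycle is determined by its lowest rung j and the next rung l above
-- it: it runs along both rails from j to l, or up to v_d when there is no such l. Thus it uses
-- one rung and has odd length, or two rungs and even length, so c_o(L_d) = d and
-- c_e(L_d) = d(d-1)/2.
--
-- In both cases the description is matched to an arbitrary cycle F by exhibiting the described
-- cycle inside F: a cycle contained in a cycle equals it.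

module Submission where

open import Defs
open import Data.Nat using (ℕ; zero; suc; pred; >-nonZero; _+_; _*_; _∸_; _^_; _%_; _≤_; _<_; z≤n; s≤s; _<?_; _≤?_; _≟_)
open import Data.Nat.Properties
open import Data.Nat.DivMod using ([m+kn]%n≡m%n)
open import Data.Nat.Tactic.RingSolver using (solve-∀)
open import Data.Bool using (Bool; true; false; _∨_; _∧_; not; if_then_else_)
open import Data.Bool.Properties using (∨-zeroʳ; ∧-zeroʳ; ∧-identityʳ; not-¬)
import Data.Bool as Bool
open import Data.Fin
  using (Fin; zero; suc; toℕ; fromℕ<; fromℕ; inject₁; _↑ˡ_; _↑ʳ_; splitAt; join; combine; remQuot; punchIn; punchOut)
  renaming (_≟_ to _≟ᶠ_)
open import Data.Fin.Patterns using (0F; 1F; 2F; 3F)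
open import Data.Fin.Properties
  using (toℕ-injective; toℕ-fromℕ<; fromℕ<-toℕ; toℕ<n; toℕ-↑ˡ; toℕ-↑ʳ; toℕ-inject₁; toℕ-lower₁; lower₁-inject₁′; toℕ-fromℕ;
         splitAt-↑ˡ; splitAt-↑ʳ; join-splitAt; remQuot-combine; combine-remQuot; punchInᵢ≢i; punchIn-punchOut; punchIn-injective; any?)
open import Data.Fin.Subset using (Subset; _∈_; _⊆_; _∩_; ∣_∣)
open import Data.Vec using (Vec; []; _∷_; tabulate; lookup)
open import Data.Vec.Properties using (lookup-zipWith; lookup∘tabulate; tabulate∘lookup; tabulate-cong; []=⇒lookup; lookup⇒[]=; ∷-injectiveʳ)
open import Data.Product using (∃-syntax; _×_; _,_; proj₁; proj₂; map₂; uncurry)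
open import Data.Sum using (_⊎_; inj₁; inj₂; [_,_]′)
open import Data.Empty using (⊥; ⊥-elim)
open import Data.List using (List; []; _∷_; map; _++_; length; upTo; allFin)
open import Data.List.Properties using (length-map; length-++; length-upTo; length-tabulate)
open import Data.List.Membership.Propositional using () renaming (_∈_ to _∈L_)
open import Data.List.Membership.Propositional.Properties using (∈-map⁺; ∈-map⁻; ∈-upTo⁺; ∈-upTo⁻; ∈-++⁺ˡ; ∈-++⁺ʳ; ∈-++⁻; ∈-allFin)
open import Data.List.Relation.Unary.Unique.Propositional using (Unique)
import Data.List.Relation.Unary.Unique.Propositional.Properties as Unique
open import Data.List.Relation.Unary.All using (All; []; _∷_)
open import Data.List.Relation.Unary.AllPairs using ([]; _∷_)
open import Data.List.Relation.Unary.Any using (here; there)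
open import Relation.Nullary using (¬_; Dec; yes; no)
open import Relation.Nullary.Decidable using (⌊_⌋; dec-true; dec-false; isYes≗does; _×-dec_)
open import Relation.Binary.Definitions using (tri<; tri≈; tri>)
open import Relation.Binary.PropositionalEquality
open import Relation.Binary.Construct.Closure.ReflexiveTransitive using (Star; ε; _◅_; _◅◅_; reverse)
open import Function.Base using (_∘_)
open import Function.Bundles using (mk⇔)
open import Algebra.Properties.Semiring.Sum +-*-semiring
  using (sum; sum-cong-≗; sum-replicate-zero; sum-remove; ∑-distrib-+; *-distribʳ-sum)

bit : Bool → ℕ
bit true  = 1
bit false = 0

ZeroOrTwo : ℕ → Set
ZeroOrTwo n = n ≡ 0 ⊎ n ≡ 2

zeroOrTwo[b+b] : ∀ b → ZeroOrTwo (bit b + bit b)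
zeroOrTwo[b+b] true  = inj₂ refl
zeroOrTwo[b+b] false = inj₁ refl

zeroOrTwo[m+n]⇒m≡n : ∀ {a b} → a ≤ 1 → b ≤ 1 → ZeroOrTwo (a + b) → a ≡ b
zeroOrTwo[m+n]⇒m≡n z≤n       z≤n       _        = refl
zeroOrTwo[m+n]⇒m≡n (s≤s z≤n) (s≤s z≤n) _        = refl
zeroOrTwo[m+n]⇒m≡n z≤n       (s≤s z≤n) (inj₁ ())
zeroOrTwo[m+n]⇒m≡n z≤n       (s≤s z≤n) (inj₂ ())
zeroOrTwo[m+n]⇒m≡n (s≤s z≤n) z≤n       (inj₁ ())
zeroOrTwo[m+n]⇒m≡n (s≤s z≤n) z≤n       (inj₂ ())

zeroOrTwo[a+b]⇒a≡b : ∀ a b → ZeroOrTwo (bit a + bit b) → a ≡ b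
zeroOrTwo[a+b]⇒a≡b true  true  _        = refl
zeroOrTwo[a+b]⇒a≡b false false _        = refl
zeroOrTwo[a+b]⇒a≡b true  false (inj₁ ())
zeroOrTwo[a+b]⇒a≡b true  false (inj₂ ())
zeroOrTwo[a+b]⇒a≡b false true  (inj₁ ())
zeroOrTwo[a+b]⇒a≡b false true  (inj₂ ())

bit+bit≡0 : ∀ a b → bit a + bit b ≡ 0 → a ≡ false × b ≡ false
bit+bit≡0 false false _ = refl , refl

bit+bit≡1 : ∀ a b → bit a + bit b ≡ 1 → a ≡ not b
bit+bit≡1 true  false _ = refl
bit+bit≡1 false true  _ = refl

bit+bit≤1 : ∀ a b → ¬ (a ≡ true × b ≡ true) → bit a + bit b ≤ 1
bit+bit≤1 true  true  ¬both = ⊥-elim (¬both (refl , refl))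
bit+bit≤1 true  false _     = s≤s z≤n
bit+bit≤1 false true  _     = s≤s z≤n
bit+bit≤1 false false _     = z≤n

zeroOrTwo[b+0+0]⇒b≡false : ∀ b → ZeroOrTwo ((bit b + 0) + 0) → b ≡ false
zeroOrTwo[b+0+0]⇒b≡false false _ = refl
zeroOrTwo[b+0+0]⇒b≡false true (inj₁ ())
zeroOrTwo[b+0+0]⇒b≡false true (inj₂ ())

zeroOrTwo[b+0+1]⇒b≡true : ∀ b → ZeroOrTwo ((bit b + 0) + 1) → b ≡ true
zeroOrTwo[b+0+1]⇒b≡true true _ = refl
zeroOrTwo[b+0+1]⇒b≡true false (inj₁ ())
zeroOrTwo[b+0+1]⇒b≡true false (inj₂ ())

zeroOrTwo[b+1+0]⇒b≡true : ∀ b → ZeroOrTwo ((bit b + 1) + 0) → b ≡ true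
zeroOrTwo[b+1+0]⇒b≡true true _ = refl
zeroOrTwo[b+1+0]⇒b≡true false (inj₁ ())
zeroOrTwo[b+1+0]⇒b≡true false (inj₂ ())

⌊⌋-yes : ∀ {A : Set} (a? : Dec A) → A → ⌊ a? ⌋ ≡ true
⌊⌋-yes a? a = trans (isYes≗does a?) (dec-true a? a)

⌊⌋-no : ∀ {A : Set} (a? : Dec A) → ¬ A → ⌊ a? ⌋ ≡ false
⌊⌋-no a? ¬a = trans (isYes≗does a?) (dec-false a? ¬a)

⌊⌋-true⇒ : ∀ {A : Set} (a? : Dec A) → ⌊ a? ⌋ ≡ true → A
⌊⌋-true⇒ (yes a) _ = a

sum-ones : ∀ n → sum {n} (λ _ → 1) ≡ n
sum-ones zero    = refl
sum-ones (suc n) = cong suc (sum-ones n)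

sum-zero : ∀ {n} (f : Fin n → ℕ) → (∀ i → f i ≡ 0) → sum f ≡ 0
sum-zero {n} f h = trans (sum-cong-≗ h) (sum-replicate-zero n)

sum-mono-≤ : ∀ {n} (f g : Fin n → ℕ) → (∀ i → f i ≤ g i) → sum f ≤ sum g
sum-mono-≤ {zero}  f g h = z≤n
sum-mono-≤ {suc n} f g h = +-mono-≤ (h zero) (sum-mono-≤ (f ∘ suc) (g ∘ suc) (h ∘ suc))

sum-mono-< : ∀ {n} (f g : Fin n → ℕ) → (∀ i → f i ≤ g i) → ∀ a → f a < g a → sum f < sum g
sum-mono-< {suc n} f g h zero    lt = +-mono-<-≤ lt (sum-mono-≤ (f ∘ suc) (g ∘ suc) (h ∘ suc))
sum-mono-< {suc n} f g h (suc a) lt = +-mono-≤-< (h zero) (sum-mono-< (f ∘ suc) (g ∘ suc) (h ∘ suc) a lt)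

≤-sum : ∀ {n} (f : Fin n → ℕ) a → f a ≤ sum f
≤-sum {suc n} f zero    = m≤m+n _ _
≤-sum {suc n} f (suc a) = ≤-trans (≤-sum (f ∘ suc) a) (m≤n+m _ _)

toℕ≡⇒≡fromℕ< : ∀ {n a} (a<n : a < n) {i : Fin n} → toℕ i ≡ a → i ≡ fromℕ< a<n
toℕ≡⇒≡fromℕ< a<n eq = toℕ-injective (trans eq (sym (toℕ-fromℕ< a<n)))

sum-single : ∀ {n} (f : Fin n → ℕ) a → (∀ i → i ≢ a → f i ≡ 0) → sum f ≡ f a
sum-single {suc n} f a h = begin
  sum f                           ≡⟨ sum-remove f ⟩
  f a + sum (f ∘ punchIn a)       ≡⟨ cong (f a +_) (sum-zero _ (λ j → h (punchIn a j) (punchInᵢ≢i a j))) ⟩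
  f a + 0                         ≡⟨ +-identityʳ (f a) ⟩
  f a                             ∎
  where open ≡-Reasoning

sum-pair : ∀ {n} (f : Fin n → ℕ) a b → a ≢ b → (∀ i → i ≢ a → i ≢ b → f i ≡ 0) → sum f ≡ f a + f b
sum-pair {suc n} f a b a≢b h = begin
  sum f                           ≡⟨ sum-remove f ⟩
  f a + sum (f ∘ punchIn a)       ≡⟨ cong (f a +_) (sum-single (f ∘ punchIn a) b′ others) ⟩
  f a + f (punchIn a b′)          ≡⟨ cong (λ i → f a + f i) (punchIn-punchOut a≢b) ⟩
  f a + f b                       ∎
  where
  open ≡-Reasoning
  b′ = punchOut a≢b
  others : ∀ j → j ≢ b′ → f (punchIn a j) ≡ 0
  others j j≢b′ = h (punchIn a j) (punchInᵢ≢i a j)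
    (λ eq → j≢b′ (punchIn-injective a j b′ (trans eq (sym (punchIn-punchOut a≢b)))))

sum-↑ : ∀ m {n} (f : Fin (m + n) → ℕ) → sum f ≡ sum (λ i → f (i ↑ˡ n)) + sum (λ j → f (m ↑ʳ j))
sum-↑ zero    f = refl
sum-↑ (suc m) f = trans (cong (f zero +_) (sum-↑ m (f ∘ suc))) (sym (+-assoc (f zero) _ _))

sum-combine : ∀ m {n} (f : Fin (m * n) → ℕ) → sum f ≡ sum {m} (λ i → sum {n} (λ j → f (combine i j)))
sum-combine zero    f = refl
sum-combine (suc m) {n} f = trans (sum-↑ n f) (cong (sum (λ j → f (j ↑ˡ (m * n))) +_) (sum-combine m (λ i → f (n ↑ʳ i))))

∑< : ℕ → (ℕ → ℕ) → ℕ
∑< n g = sum {n} (g ∘ toℕ)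

∑<-cong : ∀ n {g h : ℕ → ℕ} → (∀ x → x < n → g x ≡ h x) → ∑< n g ≡ ∑< n h
∑<-cong n eq = sum-cong-≗ (λ i → eq (toℕ i) (toℕ<n i))

∑<-zero : ∀ n (g : ℕ → ℕ) → (∀ x → x < n → g x ≡ 0) → ∑< n g ≡ 0
∑<-zero n g h = sum-zero (g ∘ toℕ) (λ i → h (toℕ i) (toℕ<n i))

∑<-single : ∀ n (g : ℕ → ℕ) a → a < n → (∀ x → x < n → x ≢ a → g x ≡ 0) → ∑< n g ≡ g a
∑<-single n g a a<n h = trans
  (sum-single (g ∘ toℕ) (fromℕ< a<n) (λ i i≢a → h (toℕ i) (toℕ<n i) (i≢a ∘ toℕ≡⇒≡fromℕ< a<n)))
  (cong g (toℕ-fromℕ< a<n))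

∑<-pair : ∀ n (g : ℕ → ℕ) a b → a < n → b < n → a ≢ b → (∀ x → x < n → x ≢ a → x ≢ b → g x ≡ 0) →
  ∑< n g ≡ g a + g b
∑<-pair n g a b a<n b<n a≢b h = trans
  (sum-pair (g ∘ toℕ) (fromℕ< a<n) (fromℕ< b<n)
    (λ eq → a≢b (trans (sym (toℕ-fromℕ< a<n)) (trans (cong toℕ eq) (toℕ-fromℕ< b<n))))
    (λ i i≢a i≢b → h (toℕ i) (toℕ<n i) (i≢a ∘ toℕ≡⇒≡fromℕ< a<n) (i≢b ∘ toℕ≡⇒≡fromℕ< b<n)))
  (cong₂ _+_ (cong g (toℕ-fromℕ< a<n)) (cong g (toℕ-fromℕ< b<n)))

∑<-+ : ∀ m n (g : ℕ → ℕ) → ∑< (m + n) g ≡ ∑< m g + ∑< n (λ y → g (m + y))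
∑<-+ m n g = trans (sum-↑ m (g ∘ toℕ))
  (cong₂ _+_ (sum-cong-≗ {m} (λ i → cong g (toℕ-↑ˡ i n))) (sum-cong-≗ {n} (λ j → cong g (toℕ-↑ʳ m j))))

∑<-suc : ∀ n (g : ℕ → ℕ) → ∑< (suc n) g ≡ ∑< n g + g n
∑<-suc zero    g = +-comm (g 0) 0
∑<-suc (suc n) g = trans (cong (g 0 +_) (∑<-suc n (g ∘ suc))) (sym (+-assoc (g 0) _ _))

∑<-reverse : ∀ n (g : ℕ → ℕ) → ∑< n (λ y → g (n ∸ suc y)) ≡ ∑< n g
∑<-reverse zero    g = refl
∑<-reverse (suc n) g = trans (cong (g n +_) (∑<-reverse n g)) (trans (+-comm (g n) _) (sym (∑<-suc n g)))

∣p∣≡sum : ∀ {n} (p : Subset n) → ∣ p ∣ ≡ sum (bit ∘ lookup p)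
∣p∣≡sum []          = refl
∣p∣≡sum (true ∷ p)  = cong suc (∣p∣≡sum p)
∣p∣≡sum (false ∷ p) = ∣p∣≡sum p

lookup-extensionality : ∀ {A : Set} {n} (xs ys : Vec A n) → (∀ i → lookup xs i ≡ lookup ys i) → xs ≡ ys
lookup-extensionality xs ys h = trans (sym (tabulate∘lookup xs)) (trans (tabulate-cong h) (tabulate∘lookup ys))

∈⇒lookup : ∀ {n} {e : Fin n} {F : Subset n} → e ∈ F → lookup F e ≡ true
∈⇒lookup = []=⇒lookup

lookup⇒∈ : ∀ {n} {e : Fin n} {F : Subset n} → lookup F e ≡ true → e ∈ F
lookup⇒∈ {e = e} {F} = lookup⇒[]= e F

Unique-map⁺ : ∀ {A B : Set} (f : A → B) {xs : List A} → Unique xs →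
  (∀ {x y} → x ∈L xs → y ∈L xs → f x ≡ f y → x ≡ y) → Unique (map f xs)
Unique-map⁺ f {[]}     _           _   = []
Unique-map⁺ f {x ∷ xs} (x∉ ∷ uniq) inj = distinct xs x∉ there ∷ Unique-map⁺ f uniq (λ p q → inj (there p) (there q))
  where
  distinct : ∀ ys → All (λ y → ¬ x ≡ y) ys → (∀ {y} → y ∈L ys → y ∈L x ∷ xs) → All (λ z → ¬ f x ≡ z) (map f ys)
  distinct []       []         _   = []
  distinct (y ∷ ys) (x≢y ∷ ne) sub = (λ eq → x≢y (inj (here refl) (sub (here refl)) eq)) ∷ distinct ys ne (sub ∘ there)

-- Cycles of a graph

module _ (G : Graph) where
  open Graph G

  isEndpoint : V → V × V → Bool
  isEndpoint v (x , y) = ⌊ v ≟V x ⌋ ∨ ⌊ v ≟V y ⌋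

  isEndpointˡ : ∀ v y → isEndpoint v (v , y) ≡ true
  isEndpointˡ v y rewrite ⌊⌋-yes (v ≟V v) refl = refl

  isEndpointʳ : ∀ x v → isEndpoint v (x , v) ≡ true
  isEndpointʳ x v rewrite ⌊⌋-yes (v ≟V v) refl = ∨-zeroʳ _

  bit∧isEndpointˡ : ∀ b v y → bit (b ∧ isEndpoint v (v , y)) ≡ bit b
  bit∧isEndpointˡ b v y rewrite isEndpointˡ v y = cong bit (∧-identityʳ b)

  bit∧isEndpointʳ : ∀ b x v → bit (b ∧ isEndpoint v (x , v)) ≡ bit b
  bit∧isEndpointʳ b x v rewrite isEndpointʳ x v = cong bit (∧-identityʳ b)

  bit∧isEndpoint-off : ∀ b v x y → v ≢ x → v ≢ y → bit (b ∧ isEndpoint v (x , y)) ≡ 0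
  bit∧isEndpoint-off b v x y v≢x v≢y rewrite ⌊⌋-no (v ≟V x) v≢x | ⌊⌋-no (v ≟V y) v≢y = cong bit (∧-zeroʳ b)

  incident≡isEndpoint : ∀ v e → incident G v e ≡ isEndpoint v (edge e)
  incident≡isEndpoint v e with edge e
  ... | (x , y) = refl

  degTerm : EdgeSet G → V → Fin m → ℕ
  degTerm F v e = bit (lookup F e ∧ isEndpoint v (edge e))

  deg≡sum : ∀ F v → deg G F v ≡ sum (degTerm F v)
  deg≡sum F v = trans (∣p∣≡sum (F ∩ tabulate (incident G v))) (sum-cong-≗ λ e →
    cong bit (trans (lookup-zipWith _∧_ e F (tabulate (incident G v)))
                    (cong (lookup F e ∧_) (trans (lookup∘tabulate _ e) (incident≡isEndpoint v e)))))

  sharedEndpoint⇒Step : ∀ F {e f} v → lookup F e ≡ true → lookup F f ≡ true →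
    isEndpoint v (edge e) ≡ true → isEndpoint v (edge f) ≡ true → Step G F e f
  sharedEndpoint⇒Step F {e} {f} v e∈F f∈F ve vf =
    lookup⇒∈ e∈F , lookup⇒∈ f∈F , v , trans (incident≡isEndpoint v e) ve , trans (incident≡isEndpoint v f) vf

  Star-sym : ∀ F {e f} → Star (Step G F) e f → Star (Step G F) f e
  Star-sym F = reverse λ (e∈ , f∈ , v , ve , vf) → f∈ , e∈ , v , vf , ve

  rooted⇒Connected : ∀ F r → (∀ e → e ∈ F → Star (Step G F) e r) → Connected G F
  rooted⇒Connected F r reach e f e∈F f∈F = reach e e∈F ◅◅ Star-sym F (reach f f∈F)

  degTerm-mono : ∀ {S F} → S ⊆ F → ∀ v e → degTerm S v e ≤ degTerm F v e
  degTerm-mono {S} {F} S⊆F v e with lookup S e in Se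
  ... | false = z≤n
  ... | true rewrite ∈⇒lookup (S⊆F (lookup⇒∈ Se)) = ≤-refl

  degTerm-at : ∀ F v e → lookup F e ≡ true → incident G v e ≡ true → degTerm F v e ≡ 1
  degTerm-at F v e Fe ve rewrite Fe | sym (incident≡isEndpoint v e) | ve = refl

  -- v lies on an edge of S, so it has degree 2 in S; an F-edge at v outside S would raise its degree in F above 2.
  ⊆-cycle-Step-closed : ∀ {S F} → IsCycle G S → (∀ v → ZeroOrTwo (deg G F v)) → S ⊆ F →
    ∀ {e f} → Step G F e f → lookup S e ≡ true → lookup S f ≡ true
  ⊆-cycle-Step-closed {S} {F} (_ , degS , _) degF S⊆F {e} {f} (_ , f∈F , v , ve , vf) Se with lookup S f in Sf
  ... | true  = refl
  ... | false = ⊥-elim (too-many (degS v) (degF v))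
    where
    degS≥1 : 1 ≤ deg G S v
    degS≥1 = subst (_≤ deg G S v) (degTerm-at S v e Se ve) (subst (degTerm S v e ≤_) (sym (deg≡sum S v)) (≤-sum _ e))
    S<F : deg G S v < deg G F v
    S<F = subst₂ _<_ (sym (deg≡sum S v)) (sym (deg≡sum F v))
      (sum-mono-< _ _ (degTerm-mono S⊆F v) f (subst₂ _<_ (sym (cong (λ b → bit (b ∧ _)) Sf))
                                                          (sym (degTerm-at F v f (∈⇒lookup f∈F) vf)) (s≤s z≤n)))
    too-many : ZeroOrTwo (deg G S v) → ZeroOrTwo (deg G F v) → ⊥
    too-many (inj₁ S≡0) _          = 1+n≰n (≤-trans degS≥1 (≤-reflexive S≡0))
    too-many (inj₂ S≡2) (inj₁ F≡0) = <-irrefl (sym F≡0) (≤-<-trans z≤n S<F)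
    too-many (inj₂ S≡2) (inj₂ F≡2) = <-irrefl (trans S≡2 (sym F≡2)) S<F

  ⊆-cycle⇒≡ : ∀ {S F} → IsCycle G S → IsCycle G F → S ⊆ F → S ≡ F
  ⊆-cycle⇒≡ {S} {F} cycS@((s , s∈S) , _) (_ , degF , connF) S⊆F = lookup-extensionality S F pointwise
    where
    reach : ∀ {e f} → Star (Step G F) e f → lookup S e ≡ true → lookup S f ≡ true
    reach ε          h = h
    reach (st ◅ sts) h = reach sts (⊆-cycle-Step-closed cycS degF S⊆F st h)
    pointwise : ∀ i → lookup S i ≡ lookup F i
    pointwise i with lookup S i in Si | lookup F i in Fi
    ... | true  | true  = refl
    ... | false | false = refl
    ... | true  | false = trans (sym (∈⇒lookup (S⊆F (lookup⇒∈ Si)))) Fi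
    ... | false | true  = trans (sym Si) (reach (connF s i (S⊆F s∈S) (lookup⇒∈ Fi)) (∈⇒lookup s∈S))

  HasCount-map : ∀ {A : Set} (P : EdgeSet G → Set) (f : A → EdgeSet G) (xs : List A) → Unique xs →
    (∀ {x y} → x ∈L xs → y ∈L xs → f x ≡ f y → x ≡ y) →
    (∀ {x} → x ∈L xs → P (f x)) → (∀ F → P F → ∃[ x ] x ∈L xs × F ≡ f x) →
    HasCount G P (length xs)
  HasCount-map P f xs uniq inj sound complete =
    map f xs , Unique-map⁺ f uniq inj , (λ F → mk⇔ (to F) (from F)) , length-map f xs
    where
    to : ∀ F → F ∈L map f xs → P F
    to F F∈ with ∈-map⁻ f F∈
    ... | (x , x∈ , refl) = sound x∈
    from : ∀ F → P F → F ∈L map f xs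
    from F PF with complete F PF
    ... | (x , x∈ , refl) = ∈-map⁺ f x∈

-- The graph R_k

next-cases : ∀ {n} (i : Fin (suc n)) → (toℕ i ≡ n × next i ≡ zero) ⊎ toℕ (next i) ≡ suc (toℕ i)
next-cases {n} i with n ≟ toℕ i
... | yes n≡i = inj₁ (sym n≡i , refl)
... | no n≢i  = inj₂ (cong suc (toℕ-lower₁ i n≢i))

next-inject₁ : ∀ {n} (j : Fin n) → next {suc n} (inject₁ j) ≡ suc j
next-inject₁ {n} j with n ≟ toℕ (inject₁ j)
... | yes n≡j = ⊥-elim (<-irrefl (sym (trans n≡j (toℕ-inject₁ j))) (toℕ<n j))
... | no n≢j  = cong suc (lower₁-inject₁′ j n≢j)

next-fromℕ : ∀ n → next {suc n} (fromℕ n) ≡ zero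
next-fromℕ n with n ≟ toℕ (fromℕ n)
... | yes _   = refl
... | no n≢n  = ⊥-elim (n≢n (sym (toℕ-fromℕ n)))

next-surjective : ∀ {n} (w : Fin (suc n)) → ∃[ i ] next i ≡ w
next-surjective {n} zero = fromℕ n , next-fromℕ n
next-surjective (suc j)  = inject₁ j , next-inject₁ j

next-injective : ∀ {n} {i i′ : Fin (suc n)} → next i ≡ next i′ → i ≡ i′
next-injective {i = i} {i′} eq with next-cases i | next-cases i′
... | inj₁ (i≡n , _)  | inj₁ (i′≡n , _) = toℕ-injective (trans i≡n (sym i′≡n))
... | inj₁ (_ , z)    | inj₂ s          = ⊥-elim (0≢1+n (trans (cong toℕ (trans (sym z) eq)) s))
... | inj₂ s          | inj₁ (_ , z)    = ⊥-elim (0≢1+n (trans (cong toℕ (trans (sym z) (sym eq))) s))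
... | inj₂ s          | inj₂ s′         = toℕ-injective (suc-injective (trans (sym s) (trans (cong toℕ eq) s′)))

next≢id : ∀ {n} (i : Fin (suc (suc n))) → next i ≢ i
next≢id i eq with next-cases i
... | inj₁ (i≡n , z) = 0≢1+n (trans (cong toℕ (trans (sym z) eq)) i≡n)
... | inj₂ s         = <-irrefl (sym (trans (sym s) (cong toℕ eq))) (n<1+n _)

next-induction : ∀ {n} (P : Fin (suc n) → Set) → P zero → (∀ i → P i → P (next i)) → ∀ i → P i
next-induction {n} P base step i = go (toℕ i) i refl
  where
  go : ∀ t (i : Fin (suc n)) → toℕ i ≡ t → P i
  go t       zero    _  = base
  go (suc t) (suc j) eq = subst P (next-inject₁ j)
    (step (inject₁ j) (go t (inject₁ j) (trans (toℕ-inject₁ j) (suc-injective eq))))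

allVecs : ∀ n → List (Vec Bool n)
allVecs zero    = [] ∷ []
allVecs (suc n) = map (true ∷_) (allVecs n) ++ map (false ∷_) (allVecs n)

length-allVecs : ∀ n → length (allVecs n) ≡ 2 ^ n
length-allVecs zero    = refl
length-allVecs (suc n) = begin
  length (map (true ∷_) (allVecs n) ++ map (false ∷_) (allVecs n))
    ≡⟨ length-++ (map (true ∷_) (allVecs n)) ⟩
  length (map (true ∷_) (allVecs n)) + length (map (false ∷_) (allVecs n))
    ≡⟨ cong₂ _+_ (length-map _ (allVecs n)) (length-map _ (allVecs n)) ⟩
  length (allVecs n) + length (allVecs n)
    ≡⟨ cong (λ l → l + l) (length-allVecs n) ⟩
  2 ^ n + 2 ^ n
    ≡⟨ cong (2 ^ n +_) (sym (+-identityʳ (2 ^ n))) ⟩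
  2 ^ suc n ∎
  where open ≡-Reasoning

∈-allVecs : ∀ {n} (v : Vec Bool n) → v ∈L allVecs n
∈-allVecs []               = here refl
∈-allVecs {suc n} (true ∷ v)  = ∈-++⁺ˡ (∈-map⁺ (true ∷_) (∈-allVecs v))
∈-allVecs {suc n} (false ∷ v) = ∈-++⁺ʳ (map (true ∷_) (allVecs n)) (∈-map⁺ (false ∷_) (∈-allVecs v))

allVecs-unique : ∀ n → Unique (allVecs n)
allVecs-unique zero    = [] ∷ []
allVecs-unique (suc n) = Unique.++⁺ (Unique.map⁺ ∷-injectiveʳ (allVecs-unique n))
  (Unique.map⁺ ∷-injectiveʳ (allVecs-unique n)) disjoint
  where
  disjoint : ∀ {v} → v ∈L map (true ∷_) (allVecs n) × v ∈L map (false ∷_) (allVecs n) → ⊥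
  disjoint (p , q) with ∈-map⁻ (true ∷_) p | ∈-map⁻ (false ∷_) q
  ... | (_ , _ , refl) | (_ , _ , ())

module RingOfSquares (n : ℕ) where

  k : ℕ
  k = suc (suc n)

  G : Graph
  G = R k

  open Graph G using (edge; _≟V_)

  -- The local edge layout of R is not exported by Defs, so it is restated here:
  -- (i , 0F) = v_i, (i , 1F) = a_i, (i , 2F) = b_i, and D_i = v_i v_{i+1} b_i a_i.
  edgeᴿ : Fin k → Fin 4 → (Fin k × Fin 3) × (Fin k × Fin 3)
  edgeᴿ i 0F = (i , 0F) , (next i , 0F)
  edgeᴿ i 1F = (next i , 0F) , (i , 2F)
  edgeᴿ i 2F = (i , 2F) , (i , 1F)
  edgeᴿ i 3F = (i , 1F) , (i , 0F)

  edgeIndex : Fin k → Fin 4 → Fin (k * 4)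
  edgeIndex = combine

  edge-edgeIndex : ∀ i j → edge (edgeIndex i j) ≡ edgeᴿ i j
  edge-edgeIndex i 0F rewrite remQuot-combine {k} {4} i 0F = refl
  edge-edgeIndex i 1F rewrite remQuot-combine {k} {4} i 1F = refl
  edge-edgeIndex i 2F rewrite remQuot-combine {k} {4} i 2F = refl
  edge-edgeIndex i 3F rewrite remQuot-combine {k} {4} i 3F = refl

  ∀-edgeIndex : (P : Fin (k * 4) → Set) → (∀ i j → P (edgeIndex i j)) → ∀ e → P e
  ∀-edgeIndex P h e = subst P (combine-remQuot {k} 4 e) (h (proj₁ (remQuot {k} 4 e)) (proj₂ (remQuot {k} 4 e)))

  on : EdgeSet G → Fin k → Fin 4 → Bool
  on F i j = lookup F (edgeIndex i j)

  χ : EdgeSet G → Fin k → Fin 4 → ℕ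
  χ F i j = bit (on F i j)

  _==_ : Fin k → Fin k → Bool
  a == b = ⌊ a ≟ᶠ b ⌋

  ==-refl : ∀ a → (a == a) ≡ true
  ==-refl a = ⌊⌋-yes (a ≟ᶠ a) refl

  ==-≢ : ∀ {a b} → a ≢ b → (a == b) ≡ false
  ==-≢ {a} {b} = ⌊⌋-no (a ≟ᶠ b)

  ≟V-pair : ∀ w x a y → ⌊ (w , x) ≟V (a , y) ⌋ ≡ ⌊ x ≟ᶠ y ⌋ ∧ (w == a)
  ≟V-pair w x a y = go ((w , x) ≟V (a , y)) (x ≟ᶠ y) (w ≟ᶠ a)
    where
    go : (d : Dec ((w , x) ≡ (a , y))) (d₁ : Dec (x ≡ y)) (d₂ : Dec (w ≡ a)) → ⌊ d ⌋ ≡ ⌊ d₁ ⌋ ∧ ⌊ d₂ ⌋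
    go (yes _)  (yes refl) (yes refl) = refl
    go (no ne)  (yes refl) (yes refl) = ⊥-elim (ne refl)
    go (no _)   (yes _)    (no _)     = refl
    go (yes eq) (yes _)    (no ne)    = ⊥-elim (ne (cong proj₁ eq))
    go (no _)   (no _)     _          = refl
    go (yes eq) (no ne)    _          = ⊥-elim (ne (cong proj₂ eq))

  incidence : EdgeSet G → Fin k × Fin 3 → Fin k → ℕ
  incidence F v i = sum (λ j → bit (on F i j ∧ isEndpoint G v (edgeᴿ i j)))

  deg≡sum-incidence : ∀ F v → deg G F v ≡ sum (incidence F v)
  deg≡sum-incidence F v = trans (deg≡sum G F v) (trans (sum-combine k {4} (degTerm G F v))
    (sum-cong-≗ λ i → sum-cong-≗ λ j → cong (λ p → bit (on F i j ∧ isEndpoint G v p)) (edge-edgeIndex i j)))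

  incidence-v : ∀ F w i → incidence F (w , 0F) i ≡
    bit (on F i 0F ∧ ((w == i) ∨ (w == next i))) + (bit (on F i 1F ∧ ((w == next i) ∨ false)) +
    (bit (on F i 2F ∧ false) + (bit (on F i 3F ∧ (w == i)) + 0)))
  incidence-v F w i rewrite ≟V-pair w 0F i 0F | ≟V-pair w 0F (next i) 0F | ≟V-pair w 0F i 2F | ≟V-pair w 0F i 1F = refl

  incidence-a : ∀ F w i → incidence F (w , 1F) i ≡
    bit (on F i 0F ∧ false) + (bit (on F i 1F ∧ false) +
    (bit (on F i 2F ∧ (false ∨ (w == i))) + (bit (on F i 3F ∧ ((w == i) ∨ false)) + 0)))
  incidence-a F w i rewrite ≟V-pair w 1F i 0F | ≟V-pair w 1F (next i) 0F | ≟V-pair w 1F i 2F | ≟V-pair w 1F i 1F = refl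

  incidence-b : ∀ F w i → incidence F (w , 2F) i ≡
    bit (on F i 0F ∧ false) + (bit (on F i 1F ∧ (false ∨ (w == i))) +
    (bit (on F i 2F ∧ ((w == i) ∨ false)) + (bit (on F i 3F ∧ false) + 0)))
  incidence-b F w i rewrite ≟V-pair w 2F i 0F | ≟V-pair w 2F (next i) 0F | ≟V-pair w 2F i 2F | ≟V-pair w 2F i 1F = refl

  δv δa δb : EdgeSet G → Fin k → ℕ
  δv F i = (χ F (next i) 0F + χ F (next i) 3F) + (χ F i 0F + χ F i 1F)
  δa F i = χ F i 2F + χ F i 3F
  δb F i = χ F i 1F + χ F i 2F

  deg-v : ∀ F i → deg G F (next i , 0F) ≡ δv F i
  deg-v F i = trans (deg≡sum-incidence F (w , 0F))
    (trans (sum-pair (incidence F (w , 0F)) w i (next≢id i) elsewhere) (cong₂ _+_ at-w at-i))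
    where
    w = next i
    elsewhere : ∀ l → l ≢ w → l ≢ i → incidence F (w , 0F) l ≡ 0
    elsewhere l l≢w l≢i rewrite incidence-v F w l | ==-≢ (l≢w ∘ sym) | ==-≢ (l≢i ∘ next-injective ∘ sym)
      | ∧-zeroʳ (on F l 0F) | ∧-zeroʳ (on F l 1F) | ∧-zeroʳ (on F l 2F) | ∧-zeroʳ (on F l 3F) = refl
    at-w : incidence F (w , 0F) w ≡ χ F w 0F + χ F w 3F
    at-w rewrite incidence-v F w w | ==-refl w | ==-≢ (next≢id w ∘ sym)
      | ∧-identityʳ (on F w 0F) | ∧-identityʳ (on F w 3F) | ∧-zeroʳ (on F w 1F) | ∧-zeroʳ (on F w 2F)
      | +-identityʳ (χ F w 3F) = refl
    at-i : incidence F (w , 0F) i ≡ χ F i 0F + χ F i 1F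
    at-i rewrite incidence-v F w i | ==-refl w | ==-≢ (next≢id i)
      | ∧-identityʳ (on F i 0F) | ∧-identityʳ (on F i 1F) | ∧-zeroʳ (on F i 3F) | ∧-zeroʳ (on F i 2F)
      | +-identityʳ (χ F i 1F) = refl

  deg-a : ∀ F w → deg G F (w , 1F) ≡ δa F w
  deg-a F w = trans (deg≡sum-incidence F (w , 1F)) (trans (sum-single (incidence F (w , 1F)) w elsewhere) at-w)
    where
    elsewhere : ∀ l → l ≢ w → incidence F (w , 1F) l ≡ 0
    elsewhere l l≢w rewrite incidence-a F w l | ==-≢ (l≢w ∘ sym)
      | ∧-zeroʳ (on F l 0F) | ∧-zeroʳ (on F l 1F) | ∧-zeroʳ (on F l 2F) | ∧-zeroʳ (on F l 3F) = refl
    at-w : incidence F (w , 1F) w ≡ χ F w 2F + χ F w 3F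
    at-w rewrite incidence-a F w w | ==-refl w
      | ∧-identityʳ (on F w 2F) | ∧-identityʳ (on F w 3F) | ∧-zeroʳ (on F w 1F) | ∧-zeroʳ (on F w 0F)
      | +-identityʳ (χ F w 3F) = refl

  deg-b : ∀ F w → deg G F (w , 2F) ≡ δb F w
  deg-b F w = trans (deg≡sum-incidence F (w , 2F)) (trans (sum-single (incidence F (w , 2F)) w elsewhere) at-w)
    where
    elsewhere : ∀ l → l ≢ w → incidence F (w , 2F) l ≡ 0
    elsewhere l l≢w rewrite incidence-b F w l | ==-≢ (l≢w ∘ sym)
      | ∧-zeroʳ (on F l 0F) | ∧-zeroʳ (on F l 1F) | ∧-zeroʳ (on F l 2F) | ∧-zeroʳ (on F l 3F) = refl
    at-w : incidence F (w , 2F) w ≡ χ F w 1F + χ F w 2F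
    at-w rewrite incidence-b F w w | ==-refl w
      | ∧-identityʳ (on F w 2F) | ∧-identityʳ (on F w 1F) | ∧-zeroʳ (on F w 3F) | ∧-zeroʳ (on F w 0F)
      | +-identityʳ (χ F w 2F) = refl

  degrees-zeroOrTwo : ∀ F →
    (∀ i → ZeroOrTwo (δv F i)) → (∀ w → ZeroOrTwo (δa F w)) → (∀ w → ZeroOrTwo (δb F w)) →
    ∀ v → ZeroOrTwo (deg G F v)
  degrees-zeroOrTwo F hv ha hb (w , 0F) with next-surjective w
  ... | (i , refl) = subst ZeroOrTwo (sym (deg-v F i)) (hv i)
  degrees-zeroOrTwo F hv ha hb (w , 1F) = subst ZeroOrTwo (sym (deg-a F w)) (ha w)
  degrees-zeroOrTwo F hv ha hb (w , 2F) = subst ZeroOrTwo (sym (deg-b F w)) (hb w)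

  adjacent : ∀ F {i j i′ j′} v → on F i j ≡ true → on F i′ j′ ≡ true →
    isEndpoint G v (edgeᴿ i j) ≡ true → isEndpoint G v (edgeᴿ i′ j′) ≡ true → Step G F (edgeIndex i j) (edgeIndex i′ j′)
  adjacent F {i} {j} {i′} {j′} v p q vp vq = sharedEndpoint⇒Step G F v p q
    (trans (cong (isEndpoint G v) (edge-edgeIndex i j)) vp) (trans (cong (isEndpoint G v) (edge-edgeIndex i′ j′)) vq)

  edgeSet : (Fin k → Fin 4 → Bool) → EdgeSet G
  edgeSet f = tabulate (uncurry f ∘ remQuot {k} 4)

  on-edgeSet : ∀ f i j → on (edgeSet f) i j ≡ f i j
  on-edgeSet f i j = trans (lookup∘tabulate (uncurry f ∘ remQuot {k} 4) (edgeIndex i j)) (cong (uncurry f) (remQuot-combine i j))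

  ∣edgeSet∣ : ∀ f → ∣ edgeSet f ∣ ≡ sum (λ i → sum (λ j → bit (f i j)))
  ∣edgeSet∣ f = trans (∣p∣≡sum (edgeSet f)) (trans (sum-combine k {4} (bit ∘ lookup (edgeSet f)))
    (sum-cong-≗ λ i → sum-cong-≗ λ j → cong bit (on-edgeSet f i j)))

  square : Fin k → EdgeSet G
  square i₀ = edgeSet (λ i _ → i₀ == i)

  on-square : ∀ i₀ i j → on (square i₀) i j ≡ (i₀ == i)
  on-square i₀ = on-edgeSet (λ i _ → i₀ == i)

  square-isCycle : ∀ i₀ → IsCycle G (square i₀)
  square-isCycle i₀ = (edgeIndex i₀ 0F , lookup⇒∈ (full 0F)) , degrees-zeroOrTwo S hv ha hb ,
                      rooted⇒Connected G S (edgeIndex i₀ 0F) reach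
    where
    S = square i₀
    χS : ∀ i j → χ S i j ≡ bit (i₀ == i)
    χS i j = cong bit (on-square i₀ i j)
    hv : ∀ i → ZeroOrTwo (δv S i)
    hv i rewrite χS (next i) 0F | χS (next i) 3F | χS i 0F | χS i 1F with i₀ ≟ᶠ i | i₀ ≟ᶠ next i
    ... | yes refl | yes eq = ⊥-elim (next≢id i₀ (sym eq))
    ... | yes refl | no _   = inj₂ refl
    ... | no _     | yes _  = inj₂ refl
    ... | no _     | no _   = inj₁ refl
    ha : ∀ w → ZeroOrTwo (δa S w)
    ha w rewrite χS w 2F | χS w 3F = zeroOrTwo[b+b] (i₀ == w)
    hb : ∀ w → ZeroOrTwo (δb S w)
    hb w rewrite χS w 1F | χS w 2F = zeroOrTwo[b+b] (i₀ == w)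
    full : ∀ j → on S i₀ j ≡ true
    full j = trans (on-square i₀ i₀ j) (==-refl i₀)
    around : ∀ j → Star (Step G S) (edgeIndex i₀ j) (edgeIndex i₀ 0F)
    around 0F = ε
    around 1F = adjacent S {i₀} {1F} {i₀} {0F} (next i₀ , 0F) (full 1F) (full 0F)
      (isEndpointˡ G (next i₀ , 0F) (i₀ , 2F)) (isEndpointʳ G (i₀ , 0F) (next i₀ , 0F)) ◅ ε
    around 2F = adjacent S {i₀} {2F} {i₀} {1F} (i₀ , 2F) (full 2F) (full 1F)
      (isEndpointˡ G (i₀ , 2F) (i₀ , 1F)) (isEndpointʳ G (next i₀ , 0F) (i₀ , 2F)) ◅ around 1F
    around 3F = adjacent S {i₀} {3F} {i₀} {0F} (i₀ , 0F) (full 3F) (full 0F)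
      (isEndpointʳ G (i₀ , 1F) (i₀ , 0F)) (isEndpointˡ G (i₀ , 0F) (next i₀ , 0F)) ◅ ε
    reach : ∀ e → e ∈ S → Star (Step G S) e (edgeIndex i₀ 0F)
    reach = ∀-edgeIndex _ λ i j e∈S → go i j (trans (sym (on-square i₀ i j)) (∈⇒lookup e∈S))
      where
      go : ∀ i j → (i₀ == i) ≡ true → Star (Step G S) (edgeIndex i j) (edgeIndex i₀ 0F)
      go i j eq with ⌊⌋-true⇒ (i₀ ≟ᶠ i) eq
      ... | refl = around j

  ∣square∣ : ∀ i₀ → ∣ square i₀ ∣ ≡ 4
  ∣square∣ i₀ = trans (∣edgeSet∣ (λ i _ → i₀ == i))
    (trans (sum-single _ i₀ (λ i i≢i₀ → cong (λ b → sum (λ (_ : Fin 4) → bit b)) (==-≢ (i≢i₀ ∘ sym))))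
           (cong (λ b → sum (λ (_ : Fin 4) → bit b)) (==-refl i₀)))

  -- s i = true: the rim takes the detour v_{i+1} b_i a_i v_i of D_i instead of the edge v_i v_{i+1}.
  detour : Bool → Fin 4 → Bool
  detour s 0F      = not s
  detour s (suc _) = s

  rim : Vec Bool k → EdgeSet G
  rim s = edgeSet (λ i → detour (lookup s i))

  on-rim : ∀ s i j → on (rim s) i j ≡ detour (lookup s i) j
  on-rim s = on-edgeSet (λ i → detour (lookup s i))

  rim-degrees : ∀ s v → ZeroOrTwo (deg G (rim s) v)
  rim-degrees s = degrees-zeroOrTwo (rim s) hv ha hb
    where
    χF : ∀ i j → χ (rim s) i j ≡ bit (detour (lookup s i) j)
    χF i j = cong bit (on-rim s i j)
    hv : ∀ i → ZeroOrTwo (δv (rim s) i)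
    hv i rewrite χF (next i) 0F | χF (next i) 3F | χF i 0F | χF i 1F with lookup s (next i) | lookup s i
    ... | true  | true  = inj₂ refl
    ... | true  | false = inj₂ refl
    ... | false | true  = inj₂ refl
    ... | false | false = inj₂ refl
    ha : ∀ w → ZeroOrTwo (δa (rim s) w)
    ha w rewrite χF w 2F | χF w 3F = zeroOrTwo[b+b] (lookup s w)
    hb : ∀ w → ZeroOrTwo (δb (rim s) w)
    hb w rewrite χF w 1F | χF w 2F = zeroOrTwo[b+b] (lookup s w)

  -- the edge of the rim in D_i at v_i, and the one at v_{i+1}
  start end : Vec Bool k → Fin k → Fin 4
  start s i = if lookup s i then 3F else 0F
  end   s i = if lookup s i then 1F else 0F

  start-on : ∀ s i → on (rim s) i (start s i) ≡ true
  start-on s i with lookup s i in si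
  ... | true  = trans (on-rim s i 3F) si
  ... | false = trans (on-rim s i 0F) (cong not si)

  end-on : ∀ s i → on (rim s) i (end s i) ≡ true
  end-on s i with lookup s i in si
  ... | true  = trans (on-rim s i 1F) si
  ... | false = trans (on-rim s i 0F) (cong not si)

  step-via-b : ∀ F i → on F i 1F ≡ true → on F i 2F ≡ true → Step G F (edgeIndex i 1F) (edgeIndex i 2F)
  step-via-b F i p q = adjacent F {i} {1F} {i} {2F} (i , 2F) p q
    (isEndpointʳ G (next i , 0F) (i , 2F)) (isEndpointˡ G (i , 2F) (i , 1F))

  step-via-a : ∀ F i → on F i 2F ≡ true → on F i 3F ≡ true → Step G F (edgeIndex i 2F) (edgeIndex i 3F)
  step-via-a F i p q = adjacent F {i} {2F} {i} {3F} (i , 1F) p q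
    (isEndpointʳ G (i , 2F) (i , 1F)) (isEndpointˡ G (i , 1F) (i , 0F))

  rim-path-to-start : ∀ s i j → on (rim s) i j ≡ true → Star (Step G (rim s)) (edgeIndex i j) (edgeIndex i (start s i))
  rim-path-to-start s i j p with lookup s i in si | j
  ... | false | 0F    = ε
  ... | false | suc j with () ← trans (sym si) (trans (sym (on-rim s i (suc j))) p)
  ... | true  | 0F    = ⊥-elim (not-¬ (trans (sym (on-rim s i 0F)) p) (cong not si))
  ... | true  | 1F    = step-via-b (rim s) i (on′ 0F) (on′ 1F) ◅ step-via-a (rim s) i (on′ 1F) (on′ 2F) ◅ ε
    where
    on′ : ∀ j → on (rim s) i (suc j) ≡ true
    on′ j = trans (on-rim s i (suc j)) si
  ... | true  | 2F    = step-via-a (rim s) i (trans (on-rim s i 2F) si) (trans (on-rim s i 3F) si) ◅ ε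
  ... | true  | 3F    = ε

  rim-link : ∀ s i → Step G (rim s) (edgeIndex (next i) (start s (next i))) (edgeIndex i (end s i))
  rim-link s i = adjacent (rim s) {next i} {start s (next i)} {i} {end s i} (next i , 0F)
    (start-on s (next i)) (end-on s i) (at-start (lookup s (next i))) (at-end (lookup s i))
    where
    at-start : ∀ b → isEndpoint G (next i , 0F) (edgeᴿ (next i) (if b then 3F else 0F)) ≡ true
    at-start true  = isEndpointʳ G (next i , 1F) (next i , 0F)
    at-start false = isEndpointˡ G (next i , 0F) (next (next i) , 0F)
    at-end : ∀ b → isEndpoint G (next i , 0F) (edgeᴿ i (if b then 1F else 0F)) ≡ true
    at-end true  = isEndpointˡ G (next i , 0F) (i , 2F)
    at-end false = isEndpointʳ G (i , 0F) (next i , 0F)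

  rim-isCycle : ∀ s → IsCycle G (rim s)
  rim-isCycle s = (root , lookup⇒∈ (start-on s zero)) , rim-degrees s , rooted⇒Connected G (rim s) root reach
    where
    root = edgeIndex zero (start s zero)
    Path = Star (Step G (rim s))
    start-to-root : ∀ i → Path (edgeIndex i (start s i)) root
    start-to-root = next-induction _ ε (λ i p → rim-link s i ◅ rim-path-to-start s i (end s i) (end-on s i) ◅◅ p)
    reach : ∀ e → e ∈ rim s → Path e root
    reach = ∀-edgeIndex _ λ i j e∈F → rim-path-to-start s i j (∈⇒lookup e∈F) ◅◅ start-to-root i

  ∣rim∣ : ∀ s → ∣ rim s ∣ ≡ k + sum (bit ∘ lookup s) * 2
  ∣rim∣ s = begin
    ∣ rim s ∣                                        ≡⟨ ∣edgeSet∣ (λ i → detour (lookup s i)) ⟩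
    sum (λ i → sum (λ j → bit (detour (lookup s i) j)))  ≡⟨ sum-cong-≗ (λ i → per-square (lookup s i)) ⟩
    sum (λ i → 1 + bit (lookup s i) * 2)              ≡⟨ ∑-distrib-+ {k} (λ _ → 1) (λ i → bit (lookup s i) * 2) ⟩
    sum {k} (λ _ → 1) + sum (λ i → bit (lookup s i) * 2)  ≡⟨ cong₂ _+_ (sum-ones k) (sym (*-distribʳ-sum 2 (bit ∘ lookup s))) ⟩
    k + sum (bit ∘ lookup s) * 2                      ∎
    where
    open ≡-Reasoning
    per-square : ∀ b → sum (λ j → bit (detour b j)) ≡ 1 + bit b * 2
    per-square true  = refl
    per-square false = refl

  detour-uniform : ∀ {F} → IsCycle G F → ∀ w (j : Fin 3) → on F w (suc j) ≡ on F w 3F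
  detour-uniform {F} (_ , degF , _) w j = go j
    where
    1≡2 : on F w 1F ≡ on F w 2F
    1≡2 = zeroOrTwo[a+b]⇒a≡b _ _ (subst ZeroOrTwo (deg-b F w) (degF (w , 2F)))
    2≡3 : on F w 2F ≡ on F w 3F
    2≡3 = zeroOrTwo[a+b]⇒a≡b _ _ (subst ZeroOrTwo (deg-a F w) (degF (w , 1F)))
    go : ∀ j → on F w (suc j) ≡ on F w 3F
    go 0F = trans 1≡2 2≡3
    go 1F = 2≡3
    go 2F = refl

  square-⊆ : ∀ {F} → IsCycle G F → ∀ i → on F i 0F ≡ true → on F i 3F ≡ true → square i ⊆ F
  square-⊆ {F} cyc i on₀ on₃ {e} e∈S = lookup⇒∈ (∀-edgeIndex Inherited inherited e (∈⇒lookup e∈S))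
    where
    Inherited : Fin (k * 4) → Set
    Inherited e = lookup (square i) e ≡ true → lookup F e ≡ true
    full : ∀ j → on F i j ≡ true
    full 0F      = on₀
    full (suc j) = trans (detour-uniform cyc i j) on₃
    inherited : ∀ i′ j → Inherited (edgeIndex i′ j)
    inherited i′ j h with ⌊⌋-true⇒ (i ≟ᶠ i′) (trans (sym (on-square i i′ j)) h)
    ... | refl = full j

  -- the number of edges of F in D_i at v_i
  passes : EdgeSet G → Fin k → ℕ
  passes F i = χ F i 0F + χ F i 3F

  rim-cases : ∀ {F} → IsCycle G F → (∀ i → ¬ (on F i 0F ≡ true × on F i 3F ≡ true)) → ∃[ s ] F ≡ rim s
  rim-cases {F} cyc@((e , e∈F) , degF , _) no-square = go (passes F zero) (passes≤1 zero) passes-const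
    where
    passes≤1 : ∀ i → passes F i ≤ 1
    passes≤1 i = bit+bit≤1 _ _ (no-square i)
    passes-next : ∀ i → passes F (next i) ≡ passes F i
    passes-next i = zeroOrTwo[m+n]⇒m≡n (passes≤1 (next i)) (passes≤1 i)
      (subst ZeroOrTwo (trans (deg-v F i) (cong (λ b → passes F (next i) + (χ F i 0F + bit b))
                                                 (detour-uniform cyc i 0F)))
                       (degF (next i , 0F)))
    passes-const : ∀ i → passes F i ≡ passes F zero
    passes-const = next-induction _ refl (λ i p → trans (passes-next i) p)
    go : ∀ p → p ≤ 1 → (∀ i → passes F i ≡ p) → ∃[ s ] F ≡ rim s
    go 0 _ none = ⊥-elim (∀-edgeIndex (λ e → e ∈ F → ⊥) empty e e∈F)
      where
      empty : ∀ i j → edgeIndex i j ∈ F → ⊥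
      empty i j e∈F with bit+bit≡0 _ _ (none i)
      ... | (off₀ , off₃) = not-¬ (∈⇒lookup e∈F) (off j)
        where
        off : ∀ j → on F i j ≡ false
        off 0F      = off₀
        off (suc j) = trans (detour-uniform cyc i j) off₃
    go 1 _ once = s , lookup-extensionality F (rim s) (∀-edgeIndex _ λ i j → trans (pointwise i j) (sym (on-rim s i j)))
      where
      s : Vec Bool k
      s = tabulate (λ i → on F i 3F)
      pointwise : ∀ i j → on F i j ≡ detour (lookup s i) j
      pointwise i j rewrite lookup∘tabulate (λ i → on F i 3F) i with j
      ... | 0F    = bit+bit≡1 _ _ (once i)
      ... | suc j = detour-uniform cyc i j
    go (suc (suc _)) (s≤s ()) _

  cycle-cases : ∀ {F} → IsCycle G F → (∃[ i ] F ≡ square i) ⊎ (∃[ s ] F ≡ rim s)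
  cycle-cases {F} cyc with any? (λ i → (on F i 0F Bool.≟ true) ×-dec (on F i 3F Bool.≟ true))
  ... | yes (i , on₀ , on₃) = inj₁ (i , sym (⊆-cycle⇒≡ G (square-isCycle i) cyc (square-⊆ cyc i on₀ on₃)))
  ... | no ¬square          = inj₂ (rim-cases cyc (λ i both → ¬square (i , both)))

  square-injective : ∀ {i i′} → square i ≡ square i′ → i ≡ i′
  square-injective {i} {i′} eq = sym (⌊⌋-true⇒ (i′ ≟ᶠ i) (begin
    (i′ == i)         ≡⟨ sym (on-square i′ i 0F) ⟩
    on (square i′) i 0F ≡⟨ cong (λ S → on S i 0F) (sym eq) ⟩
    on (square i) i 0F  ≡⟨ on-square i i 0F ⟩
    (i == i)          ≡⟨ ==-refl i ⟩
    true              ∎))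
    where open ≡-Reasoning

  rim-injective : ∀ {s s′} → rim s ≡ rim s′ → s ≡ s′
  rim-injective {s} {s′} eq = lookup-extensionality s s′ λ i →
    trans (sym (on-rim s i 3F)) (trans (cong (λ S → on S i 3F) eq) (on-rim s′ i 3F))

  module _ (k-odd : k % 2 ≡ 1) where

    rim-odd : ∀ s → ∣ rim s ∣ % 2 ≡ 1
    rim-odd s = trans (cong (_% 2) (∣rim∣ s)) (trans ([m+kn]%n≡m%n k (sum (bit ∘ lookup s)) 2) k-odd)

    square-even : ∀ i → ∣ square i ∣ % 2 ≡ 0
    square-even i = cong (_% 2) (∣square∣ i)

    count-odd : c-odd≡ G (2 ^ k)
    count-odd = subst (c-odd≡ G) (length-allVecs k)
      (HasCount-map G (OddCycle G) rim (allVecs k) (allVecs-unique k) (λ _ _ → rim-injective)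
        (λ {s} _ → rim-isCycle s , rim-odd s) complete)
      where
      complete : ∀ F → OddCycle G F → ∃[ s ] s ∈L allVecs k × F ≡ rim s
      complete F (cyc , odd) with cycle-cases cyc
      ... | inj₁ (i , refl) = ⊥-elim (0≢1+n (trans (sym (square-even i)) odd))
      ... | inj₂ (s , refl) = s , ∈-allVecs s , refl

    count-even : c-even≡ G k
    count-even = subst (c-even≡ G) (length-tabulate (λ i → i))
      (HasCount-map G (EvenCycle G) square (allFin k) (Unique.allFin⁺ k) (λ _ _ → square-injective)
        (λ {i} _ → square-isCycle i , square-even i) complete)
      where
      complete : ∀ F → EvenCycle G F → ∃[ i ] i ∈L allFin k × F ≡ square i
      complete F (cyc , even) with cycle-cases cyc
      ... | inj₁ (i , refl) = i , ∈-allFin i , refl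
      ... | inj₂ (s , refl) = ⊥-elim (0≢1+n (trans (sym even) (rim-odd s)))

-- The graph L_d

suc[n∸suc[y]]≡n∸y : ∀ {y n} → y < n → suc (n ∸ suc y) ≡ n ∸ y
suc[n∸suc[y]]≡n∸y {y} {n} y<n = sym (+-∸-assoc 1 y<n)

FirstTrue : (ℕ → Bool) → ℕ → ℕ → Set
FirstTrue f a n = (∃[ i ] a ≤ i × i < n × f i ≡ true × (∀ y → a ≤ y → y < i → f y ≡ false))
                ⊎ (∀ y → a ≤ y → y < n → f y ≡ false)

first-true : ∀ f a n → FirstTrue f a n
first-true f a zero = inj₂ (λ _ _ ())
first-true f a (suc n) with first-true f a n
... | inj₁ (i , a≤i , i<n , fi , before) = inj₁ (i , a≤i , <-trans i<n (n<1+n n) , fi , before)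
... | inj₂ none with a ≤? n
...   | no a≰n = inj₂ (λ y a≤y y<sn → ⊥-elim (a≰n (≤-trans a≤y (≤-pred y<sn))))
...   | yes a≤n with f n in fn
...     | true  = inj₁ (n , a≤n , n<1+n n , fn , none)
...     | false = inj₂ (λ y a≤y y<sn → [ (λ y<n → none y a≤y y<n) , (λ { refl → fn }) ]′ (m≤n⇒m<n∨m≡n (≤-pred y<sn)))

suc-square : ∀ n → suc n * suc n ≡ n * n + (n + n + 1)
suc-square = solve-∀

pairs : ℕ → List (ℕ × ℕ)
pairs zero    = []
pairs (suc n) = pairs n ++ map (_, n) (upTo n)

∈-pairs⁻ : ∀ n {j l} → (j , l) ∈L pairs n → j < l × l < n
∈-pairs⁻ (suc n) p with ∈-++⁻ (pairs n) p
... | inj₁ p′ = map₂ (λ l<n → <-trans l<n (n<1+n n)) (∈-pairs⁻ n p′)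
... | inj₂ q with ∈-map⁻ (_, n) q
...   | (_ , j∈ , refl) = ∈-upTo⁻ j∈ , n<1+n n

∈-pairs⁺ : ∀ n {j l} → j < l → l < n → (j , l) ∈L pairs n
∈-pairs⁺ (suc n) {j} {l} j<l l<sn with m≤n⇒m<n∨m≡n (≤-pred l<sn)
... | inj₁ l<n  = ∈-++⁺ˡ (∈-pairs⁺ n j<l l<n)
... | inj₂ refl = ∈-++⁺ʳ (pairs n) (∈-map⁺ (_, n) (∈-upTo⁺ j<l))

pairs-unique : ∀ n → Unique (pairs n)
pairs-unique zero    = []
pairs-unique (suc n) = Unique.++⁺ (pairs-unique n) (Unique.map⁺ (cong proj₁) (Unique.upTo⁺ n)) disjoint
  where
  disjoint : ∀ {p} → p ∈L pairs n × p ∈L map (_, n) (upTo n) → ⊥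
  disjoint (p∈ , q) with ∈-map⁻ (_, n) q
  ... | (_ , _ , refl) = <-irrefl refl (proj₂ (∈-pairs⁻ n p∈))

2*∣pairs∣+n≡n*n : ∀ n → 2 * length (pairs n) + n ≡ n * n
2*∣pairs∣+n≡n*n zero    = refl
2*∣pairs∣+n≡n*n (suc n) = begin
  2 * length (pairs (suc n)) + suc n          ≡⟨ cong (λ p → 2 * p + suc n) ∣pairs[1+n]∣ ⟩
  2 * (length (pairs n) + n) + suc n          ≡⟨ rearrange (length (pairs n)) n ⟩
  (2 * length (pairs n) + n) + (n + n + 1)    ≡⟨ cong (_+ (n + n + 1)) (2*∣pairs∣+n≡n*n n) ⟩
  n * n + (n + n + 1)                         ≡⟨ sym (suc-square n) ⟩
  suc n * suc n                               ∎
  where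
  open ≡-Reasoning
  rearrange : ∀ p n → 2 * (p + n) + suc n ≡ (2 * p + n) + (n + n + 1)
  rearrange = solve-∀
  ∣pairs[1+n]∣ : length (pairs (suc n)) ≡ length (pairs n) + n
  ∣pairs[1+n]∣ = trans (length-++ (pairs n)) (cong (length (pairs n) +_) (trans (length-map _ (upTo n)) (length-upTo n)))

-- Vertex v_x is the number x, and D = 2d. Rail edge i is v_i v_{i+1} on the left rail and its
-- mirror image v_{D-1-i} v_{D-i} on the right rail; rung i is the chord v_i v_{D-i}.
module Ladder (d′ : ℕ) where

  d : ℕ
  d = suc d′

  D : ℕ
  D = 2 * d

  G : Graph
  G = L d

  open Graph G using (edge)

  D≡d+d : D ≡ d + d
  D≡d+d = cong (d +_) (+-identityʳ d)

  d<D : d < D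
  d<D = subst (d <_) (sym D≡d+d) (m<m+n d (s≤s z≤n))

  D∸d≡d : D ∸ d ≡ d
  D∸d≡d = trans (cong (_∸ d) D≡d+d) (m+n∸m≡n d d)

  d<D∸x : ∀ {x} → x < d → d < D ∸ x
  d<D∸x {x} x<d = subst (d <_) (cong (_∸ x) (sym D≡d+d))
    (subst (d <_) (sym (+-∸-assoc d (<⇒≤ x<d))) (subst (_≤ d + (d ∸ x)) (+-comm d 1) (+-monoʳ-≤ d (m<n⇒0<n∸m x<d))))

  D∸suc[D∸suc[x]]≡x : ∀ {x} → x < D → D ∸ suc (D ∸ suc x) ≡ x
  D∸suc[D∸suc[x]]≡x x<D = trans (cong (D ∸_) (suc[n∸suc[y]]≡n∸y x<D)) (m∸[m∸n]≡n (<⇒≤ x<D))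

  D∸suc<D : ∀ y → D ∸ suc y < D
  D∸suc<D y = s≤s (m∸n≤m _ y)

  pathEdge : ∀ x → .(x < D) → Fin (D + d)
  pathEdge x x<D = fromℕ< x<D ↑ˡ d

  rung : ∀ i → .(i < d) → Fin (D + d)
  rung i i<d = D ↑ʳ fromℕ< i<d

  rightEdge : ℕ → Fin (D + d)
  rightEdge i = pathEdge (D ∸ suc i) (D∸suc<D i)

  edge-pathEdge : ∀ x .(x<D : x < D) → edge (pathEdge x x<D) ≡ (x , suc x)
  edge-pathEdge x x<D rewrite splitAt-↑ˡ D (fromℕ< x<D) d | toℕ-fromℕ< x<D = refl

  edge-rung : ∀ i .(i<d : i < d) → edge (rung i i<d) ≡ (i , D ∸ i)
  edge-rung i i<d rewrite splitAt-↑ʳ D d (fromℕ< i<d) | toℕ-fromℕ< i<d = refl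

  ∀-edge : (P : Fin (D + d) → Set) → (∀ x x<D → P (pathEdge x x<D)) → (∀ i i<d → P (rung i i<d)) → ∀ e → P e
  ∀-edge P on-path on-rung e = subst P (join-splitAt D d e) (go (splitAt D e))
    where
    go : ∀ s → P (join D d s)
    go (inj₁ j) = subst P (cong (_↑ˡ d) (fromℕ<-toℕ j (toℕ<n j))) (on-path (toℕ j) (toℕ<n j))
    go (inj₂ i) = subst P (cong (D ↑ʳ_) (fromℕ<-toℕ i (toℕ<n i))) (on-rung (toℕ i) (toℕ<n i))

  pathOn : EdgeSet G → ℕ → Bool
  pathOn F x with x <? D
  ... | yes x<D = lookup F (pathEdge x x<D)
  ... | no _    = false

  rungOn : EdgeSet G → ℕ → Bool
  rungOn F i with i <? d
  ... | yes i<d = lookup F (rung i i<d)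
  ... | no _    = false

  rightOn : EdgeSet G → ℕ → Bool
  rightOn F i = pathOn F (D ∸ suc i)

  pathOn-lookup : ∀ F x (x<D : x < D) → pathOn F x ≡ lookup F (pathEdge x x<D)
  pathOn-lookup F x x<D with x <? D
  ... | yes _   = refl
  ... | no x≮D  = ⊥-elim (x≮D x<D)

  rungOn-lookup : ∀ F i (i<d : i < d) → rungOn F i ≡ lookup F (rung i i<d)
  rungOn-lookup F i i<d with i <? d
  ... | yes _   = refl
  ... | no i≮d  = ⊥-elim (i≮d i<d)

  pathTerm : EdgeSet G → ℕ → ℕ → ℕ
  pathTerm F v x = bit (pathOn F x ∧ isEndpoint G v (x , suc x))

  rungTerm : EdgeSet G → ℕ → ℕ → ℕ
  rungTerm F v i = bit (rungOn F i ∧ isEndpoint G v (i , D ∸ i))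

  deg≡path+rung : ∀ F v → deg G F v ≡ ∑< D (pathTerm F v) + ∑< d (rungTerm F v)
  deg≡path+rung F v = trans (deg≡sum G F v) (trans (sum-↑ D (degTerm G F v))
    (cong₂ _+_ (sum-cong-≗ {D} path) (sum-cong-≗ {d} rungs)))
    where
    path : ∀ j → degTerm G F v (j ↑ˡ d) ≡ pathTerm F v (toℕ j)
    path j rewrite pathOn-lookup F (toℕ j) (toℕ<n j) | fromℕ<-toℕ j (toℕ<n j) | splitAt-↑ˡ D j d = refl
    rungs : ∀ i → degTerm G F v (D ↑ʳ i) ≡ rungTerm F v (toℕ i)
    rungs i rewrite rungOn-lookup F (toℕ i) (toℕ<n i) | fromℕ<-toℕ i (toℕ<n i) | splitAt-↑ʳ D d i = refl

  -- the rail edge just below rail vertex i; there is none below v_0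
  below : (ℕ → Bool) → ℕ → ℕ
  below X zero    = 0
  below X (suc i) = bit (X i)

  deg-left : ∀ F i → i < d → deg G F i ≡ (bit (pathOn F i) + below (pathOn F) i) + bit (rungOn F i)
  deg-left F i i<d = trans (deg≡path+rung F i) (cong₂ _+_ (path i i<d) rungs)
    where
    rungs : ∑< d (rungTerm F i) ≡ bit (rungOn F i)
    rungs = trans (∑<-single d (rungTerm F i) i i<d off) (bit∧isEndpointˡ G (rungOn F i) i (D ∸ i))
      where
      off : ∀ x → x < d → x ≢ i → rungTerm F i x ≡ 0
      off x x<d x≢i = bit∧isEndpoint-off G (rungOn F x) i x (D ∸ x)
        (x≢i ∘ sym) (λ eq → <-irrefl eq (<-trans i<d (d<D∸x x<d)))
    path : ∀ i → i < d → ∑< D (pathTerm F i) ≡ bit (pathOn F i) + below (pathOn F) i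
    path zero i<d =
      trans (∑<-single D (pathTerm F 0) 0 (<-trans i<d d<D)
                       (λ x _ x≢0 → bit∧isEndpoint-off G (pathOn F x) 0 x (suc x) (x≢0 ∘ sym) (λ ())))
            (trans (bit∧isEndpointˡ G (pathOn F 0) 0 1) (sym (+-identityʳ _)))
    path (suc i) si<d =
      trans (∑<-pair D (pathTerm F (suc i)) (suc i) i (<-trans si<d d<D) (<-trans (<-trans (n<1+n i) si<d) d<D)
                     (λ eq → <-irrefl (sym eq) (n<1+n i)) off)
            (cong₂ _+_ (bit∧isEndpointˡ G (pathOn F (suc i)) (suc i) (suc (suc i))) (bit∧isEndpointʳ G (pathOn F i) i (suc i)))
      where
      off : ∀ x → x < D → x ≢ suc i → x ≢ i → pathTerm F (suc i) x ≡ 0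
      off x _ x≢si x≢i = bit∧isEndpoint-off G (pathOn F x) (suc i) x (suc x)
        (x≢si ∘ sym) (λ eq → x≢i (suc-injective (sym eq)))

  deg-right : ∀ F i → i < d → deg G F (D ∸ i) ≡ (bit (rightOn F i) + below (rightOn F) i) + bit (rungOn F i)
  deg-right F i i<d = trans (deg≡path+rung F (D ∸ i)) (cong₂ _+_ (path i i<d) rungs)
    where
    rungs : ∑< d (rungTerm F (D ∸ i)) ≡ bit (rungOn F i)
    rungs = trans (∑<-single d (rungTerm F (D ∸ i)) i i<d off) (bit∧isEndpointʳ G (rungOn F i) i (D ∸ i))
      where
      off : ∀ x → x < d → x ≢ i → rungTerm F (D ∸ i) x ≡ 0
      off x x<d x≢i = bit∧isEndpoint-off G (rungOn F x) (D ∸ i) x (D ∸ x)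
        (λ eq → <-irrefl (sym eq) (<-trans x<d (d<D∸x i<d)))
        (λ eq → x≢i (sym (∸-cancelˡ-≡ (<⇒≤ (<-trans i<d d<D)) (<⇒≤ (<-trans x<d d<D)) eq)))
    path : ∀ i → i < d → ∑< D (pathTerm F (D ∸ i)) ≡ bit (rightOn F i) + below (rightOn F) i
    path zero _ =
      trans (∑<-single D (pathTerm F D) (D ∸ 1) (D∸suc<D 0) off)
            (trans (bit∧isEndpointʳ G (pathOn F (D ∸ 1)) (D ∸ 1) D) (sym (+-identityʳ _)))
      where
      off : ∀ x → x < D → x ≢ D ∸ 1 → pathTerm F D x ≡ 0
      off x x<D x≢D-1 = bit∧isEndpoint-off G (pathOn F x) D x (suc x)
        (λ eq → <-irrefl (sym eq) x<D) (λ eq → x≢D-1 (cong pred (sym eq)))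
    path (suc i) si<d =
      trans (∑<-pair D (pathTerm F v) u v (D∸suc<D (suc i)) (D∸suc<D i)
                     (λ eq → <-irrefl (trans eq (sym su≡v)) (n<1+n u)) off)
            (cong₂ _+_ at-u (bit∧isEndpointˡ G (pathOn F v) v (suc v)))
      where
      v u : ℕ
      v = D ∸ suc i
      u = D ∸ suc (suc i)
      su≡v : suc u ≡ v
      su≡v = suc[n∸suc[y]]≡n∸y (<-trans si<d d<D)
      off : ∀ x → x < D → x ≢ u → x ≢ v → pathTerm F v x ≡ 0
      off x _ x≢u x≢v = bit∧isEndpoint-off G (pathOn F x) v x (suc x)
        (x≢v ∘ sym) (λ eq → x≢u (suc-injective (trans (sym eq) (sym su≡v))))
      at-u : pathTerm F v u ≡ bit (pathOn F u)
      at-u = subst (λ w → bit (pathOn F u ∧ isEndpoint G w (u , suc u)) ≡ bit (pathOn F u)) su≡v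
                   (bit∧isEndpointʳ G (pathOn F u) u (suc u))

  deg-middle : ∀ F → deg G F d ≡ bit (pathOn F d′) + bit (pathOn F d)
  deg-middle F = trans (deg≡path+rung F d) (trans (cong₂ _+_ path rungs) (+-identityʳ _))
    where
    rungs : ∑< d (rungTerm F d) ≡ 0
    rungs = ∑<-zero d (rungTerm F d) λ x x<d →
      bit∧isEndpoint-off G (rungOn F x) d x (D ∸ x) (λ eq → <-irrefl (sym eq) x<d) (λ eq → <-irrefl eq (d<D∸x x<d))
    path : ∑< D (pathTerm F d) ≡ bit (pathOn F d′) + bit (pathOn F d)
    path = trans (∑<-pair D (pathTerm F d) d′ d (<-trans (n<1+n d′) d<D) d<D (λ eq → <-irrefl eq (n<1+n d′))
                   (λ x _ x≢d′ x≢d → bit∧isEndpoint-off G (pathOn F x) d x (suc x) (x≢d ∘ sym) (λ eq → x≢d′ (suc-injective (sym eq)))))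
                 (cong₂ _+_ (bit∧isEndpointʳ G (pathOn F d′) d′ d) (bit∧isEndpointˡ G (pathOn F d) d (suc d)))

  deg-beyond : ∀ F v → D < v → deg G F v ≡ 0
  deg-beyond F v D<v = trans (deg≡path+rung F v) (cong₂ _+_ path rungs)
    where
    rungs : ∑< d (rungTerm F v) ≡ 0
    rungs = ∑<-zero d (rungTerm F v) λ x x<d →
      bit∧isEndpoint-off G (rungOn F x) v x (D ∸ x) (λ eq → <-irrefl (sym eq) (<-trans (<-trans x<d d<D) D<v))
                                        (λ eq → <-irrefl (sym eq) (≤-<-trans (m∸n≤m D x) D<v))
    path : ∑< D (pathTerm F v) ≡ 0
    path = ∑<-zero D (pathTerm F v) λ x x<D →
      bit∧isEndpoint-off G (pathOn F x) v x (suc x) (λ eq → <-irrefl (sym eq) (<-trans x<D D<v)) (λ eq → <-irrefl (sym eq) (≤-<-trans x<D D<v))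

  RailCondition : (ℕ → Bool) → (ℕ → Bool) → Set
  RailCondition X C = ∀ i → i < d → ZeroOrTwo ((bit (X i) + below X i) + bit (C i))

  degrees-zeroOrTwo : ∀ F → RailCondition (pathOn F) (rungOn F) → RailCondition (rightOn F) (rungOn F) →
    ZeroOrTwo (bit (pathOn F d′) + bit (pathOn F d)) → ∀ v → ZeroOrTwo (deg G F v)
  degrees-zeroOrTwo F left right middle v with v <? d
  ... | yes v<d = subst ZeroOrTwo (sym (deg-left F v v<d)) (left v v<d)
  ... | no v≮d with v ≟ d
  ...   | yes refl = subst ZeroOrTwo (sym (deg-middle F)) middle
  ...   | no v≢d with v ≤? D
  ...     | no v≰D = inj₁ (deg-beyond F v (≰⇒> v≰D))
  ...     | yes v≤D = subst ZeroOrTwo (cong (deg G F) (m∸[m∸n]≡n v≤D)) (subst ZeroOrTwo (sym (deg-right F i i<d)) (right i i<d))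
    where
    i = D ∸ v
    i<d : i < d
    i<d = <-≤-trans (∸-monoʳ-< (≤∧≢⇒< (≮⇒≥ v≮d) (v≢d ∘ sym)) v≤D) (≤-reflexive D∸d≡d)

  at-pathEdgeˡ : ∀ x .(x<D : x < D) → isEndpoint G x (edge (pathEdge x x<D)) ≡ true
  at-pathEdgeˡ x x<D = trans (cong (isEndpoint G x) (edge-pathEdge x x<D)) (isEndpointˡ G x (suc x))

  at-pathEdgeʳ : ∀ x .(x<D : x < D) → isEndpoint G (suc x) (edge (pathEdge x x<D)) ≡ true
  at-pathEdgeʳ x x<D = trans (cong (isEndpoint G (suc x)) (edge-pathEdge x x<D)) (isEndpointʳ G x (suc x))

  at-rungˡ : ∀ i .(i<d : i < d) → isEndpoint G i (edge (rung i i<d)) ≡ true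
  at-rungˡ i i<d = trans (cong (isEndpoint G i) (edge-rung i i<d)) (isEndpointˡ G i (D ∸ i))

  at-rungʳ : ∀ i .(i<d : i < d) → isEndpoint G (D ∸ i) (edge (rung i i<d)) ≡ true
  at-rungʳ i i<d = trans (cong (isEndpoint G (D ∸ i)) (edge-rung i i<d)) (isEndpointʳ G i (D ∸ i))

  Path : EdgeSet G → Fin (D + d) → Fin (D + d) → Set
  Path F = Star (Step G F)

  left-chain : ∀ F {a} i (i<D : i < D) (a≤i : a ≤ i) → (∀ y → a ≤ y → y ≤ i → pathOn F y ≡ true) →
    Path F (pathEdge i i<D) (pathEdge a (≤-<-trans a≤i i<D))
  left-chain F {a} i i<D a≤i on with a ≟ i
  ... | yes refl = ε
  left-chain F zero    i<D a≤0  on | no a≢0 = ⊥-elim (a≢0 (n≤0⇒n≡0 a≤0))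
  left-chain F {a} (suc i) i<D a≤si on | no a≢si =
    sharedEndpoint⇒Step G F (suc i) (trans (sym (pathOn-lookup F (suc i) i<D)) (on (suc i) a≤si ≤-refl))
                                    (trans (sym (pathOn-lookup F i i<D′)) (on i a≤i (n≤1+n i)))
                                    (at-pathEdgeˡ (suc i) i<D) (at-pathEdgeʳ i i<D′)
    ◅ left-chain F i i<D′ a≤i (λ y a≤y y≤i → on y a≤y (≤-trans y≤i (n≤1+n i)))
    where
    i<D′ : i < D
    i<D′ = <-trans (n<1+n i) i<D
    a≤i : a ≤ i
    a≤i = ≤-pred (≤∧≢⇒< a≤si a≢si)

  right-chain : ∀ F {a} i → i < d → a ≤ i → (∀ y → a ≤ y → y ≤ i → rightOn F y ≡ true) → Path F (rightEdge i) (rightEdge a)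
  right-chain F {a} i i<d a≤i on with a ≟ i
  ... | yes refl = ε
  right-chain F zero    i<d a≤0  on | no a≢0 = ⊥-elim (a≢0 (n≤0⇒n≡0 a≤0))
  right-chain F {a} (suc i) i<d a≤si on | no a≢si =
    sharedEndpoint⇒Step G F (D ∸ suc i) (trans (sym (pathOn-lookup F _ (D∸suc<D (suc i)))) (on (suc i) a≤si ≤-refl))
                                        (trans (sym (pathOn-lookup F _ (D∸suc<D i))) (on i a≤i (n≤1+n i)))
                                        (subst (λ w → isEndpoint G w (edge (rightEdge (suc i))) ≡ true)
                                               (suc[n∸suc[y]]≡n∸y (<-trans i<d d<D)) (at-pathEdgeʳ _ (D∸suc<D (suc i))))
                                        (at-pathEdgeˡ _ (D∸suc<D i))
    ◅ right-chain F i (<-trans (n<1+n i) i<d) a≤i (λ y a≤y y≤i → on y a≤y (≤-trans y≤i (n≤1+n i)))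
    where
    a≤i : a ≤ i
    a≤i = ≤-pred (≤∧≢⇒< a≤si a≢si)

  rung-left-step : ∀ F i (i<d : i < d) → lookup F (rung i i<d) ≡ true → pathOn F i ≡ true →
    Step G F (rung i i<d) (pathEdge i (<-trans i<d d<D))
  rung-left-step F i i<d r p = sharedEndpoint⇒Step G F i r (trans (sym (pathOn-lookup F i (<-trans i<d d<D))) p)
    (at-rungˡ i i<d) (at-pathEdgeˡ i (<-trans i<d d<D))

  rung-right-step : ∀ F i (i<d : i < d) → lookup F (rung i i<d) ≡ true → rightOn F i ≡ true →
    Step G F (rung i i<d) (rightEdge i)
  rung-right-step F i i<d r p = sharedEndpoint⇒Step G F (D ∸ i) r (trans (sym (pathOn-lookup F _ (D∸suc<D i))) p)
    (at-rungʳ i i<d) (subst (λ w → isEndpoint G w (edge (rightEdge i)) ≡ true)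
                            (suc[n∸suc[y]]≡n∸y (<-trans i<d d<D)) (at-pathEdgeʳ _ (D∸suc<D i)))

  pathEdge-cong : ∀ {x y} → x ≡ y → .(x<D : x < D) .(y<D : y < D) → pathEdge x x<D ≡ pathEdge y y<D
  pathEdge-cong refl _ _ = refl

  left-or-right : ∀ x (x<D : x < D) → x < d ⊎ ∃[ i ] i < d × pathEdge x x<D ≡ rightEdge i
  left-or-right x x<D with x <? d
  ... | yes x<d = inj₁ x<d
  ... | no x≮d  = inj₂ (D ∸ suc x , i<d , pathEdge-cong (sym (D∸suc[D∸suc[x]]≡x x<D)) x<D (D∸suc<D (D ∸ suc x)))
    where
    i<d : D ∸ suc x < d
    i<d = <-≤-trans (≤-<-trans (∸-monoʳ-≤ D (s≤s (≮⇒≥ x≮d))) (∸-monoʳ-< (n<1+n d) (≤-trans (s≤s (≮⇒≥ x≮d)) x<D)))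
                    (≤-reflexive D∸d≡d)

  RailCondition-cong : ∀ {X X′ C C′} → (∀ i → i < d → X i ≡ X′ i) → (∀ i → i < d → C i ≡ C′ i) →
    RailCondition X C → RailCondition X′ C′
  RailCondition-cong {X} {X′} {C} {C′} X≡ C≡ rc i i<d =
    subst ZeroOrTwo (cong₂ _+_ (cong₂ _+_ (cong bit (X≡ i i<d)) (below≡ i i<d)) (cong bit (C≡ i i<d))) (rc i i<d)
    where
    below≡ : ∀ i → i < d → below X i ≡ below X′ i
    below≡ zero    _   = refl
    below≡ (suc i) i<d = cong bit (X≡ i (<-trans (n<1+n i) i<d))

  railBit : (ℕ → Bool) → ℕ → Bool
  railBit X x with x <? d
  ... | yes _ = X x
  ... | no _  = X (D ∸ suc x)

  railBit-left : ∀ X x → x < d → railBit X x ≡ X x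
  railBit-left X x x<d with x <? d
  ... | yes _   = refl
  ... | no x≮d  = ⊥-elim (x≮d x<d)

  railBit-right : ∀ X i → i < d → railBit X (D ∸ suc i) ≡ X i
  railBit-right X i i<d with D ∸ suc i <? d
  ... | yes lt = ⊥-elim (<-irrefl refl (<-≤-trans lt d≤D∸suc[i]))
    where
    d≤D∸suc[i] : d ≤ D ∸ suc i
    d≤D∸suc[i] = ≤-pred (subst (d <_) (sym (suc[n∸suc[y]]≡n∸y (<-trans i<d d<D))) (d<D∸x i<d))
  ... | no _ = cong X (D∸suc[D∸suc[x]]≡x (<-trans i<d d<D))

  -- the edge set, symmetric under v_x ↦ v_{D-x}, with rung i iff C i and both rail edges of index i iff X i
  ladder : (ℕ → Bool) → (ℕ → Bool) → EdgeSet G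
  ladder X C = tabulate ([ railBit X ∘ toℕ , C ∘ toℕ ]′ ∘ splitAt D)

  lookup-ladder-path : ∀ X C x .(x<D : x < D) → lookup (ladder X C) (pathEdge x x<D) ≡ railBit X x
  lookup-ladder-path X C x x<D rewrite lookup∘tabulate ([ railBit X ∘ toℕ , C ∘ toℕ ]′ ∘ splitAt D) (pathEdge x x<D)
    | splitAt-↑ˡ D (fromℕ< x<D) d | toℕ-fromℕ< x<D = refl

  lookup-ladder-rung : ∀ X C i .(i<d : i < d) → lookup (ladder X C) (rung i i<d) ≡ C i
  lookup-ladder-rung X C i i<d rewrite lookup∘tabulate ([ railBit X ∘ toℕ , C ∘ toℕ ]′ ∘ splitAt D) (rung i i<d)
    | splitAt-↑ʳ D d (fromℕ< i<d) | toℕ-fromℕ< i<d = refl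

  pathOn-ladder : ∀ X C i → i < d → pathOn (ladder X C) i ≡ X i
  pathOn-ladder X C i i<d = trans (pathOn-lookup (ladder X C) i (<-trans i<d d<D))
    (trans (lookup-ladder-path X C i _) (railBit-left X i i<d))

  rightOn-ladder : ∀ X C i → i < d → rightOn (ladder X C) i ≡ X i
  rightOn-ladder X C i i<d = trans (pathOn-lookup (ladder X C) _ (D∸suc<D i))
    (trans (lookup-ladder-path X C _ (D∸suc<D i)) (railBit-right X i i<d))

  rungOn-ladder : ∀ X C i → i < d → rungOn (ladder X C) i ≡ C i
  rungOn-ladder X C i i<d = trans (rungOn-lookup (ladder X C) i i<d) (lookup-ladder-rung X C i i<d)

  ∣ladder∣ : ∀ X C → ∣ ladder X C ∣ ≡ ∑< d (bit ∘ C) + ∑< d (bit ∘ X) * 2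
  ∣ladder∣ X C = begin
    ∣ ladder X C ∣                                            ≡⟨ ∣p∣≡sum (ladder X C) ⟩
    sum (bit ∘ lookup (ladder X C))                           ≡⟨ sum-↑ D (bit ∘ lookup (ladder X C)) ⟩
    sum {D} (λ j → bit (lookup (ladder X C) (j ↑ˡ d))) + sum {d} (λ i → bit (lookup (ladder X C) (D ↑ʳ i)))
      ≡⟨ cong₂ _+_ (sum-cong-≗ {D} λ j → cong bit (path j)) (sum-cong-≗ {d} λ i → cong bit (rungs i)) ⟩
    ∑< D (bit ∘ railBit X) + ∑< d (bit ∘ C)                   ≡⟨ cong (_+ ∑< d (bit ∘ C)) rails ⟩
    ∑< d (bit ∘ X) * 2 + ∑< d (bit ∘ C)                       ≡⟨ +-comm _ (∑< d (bit ∘ C)) ⟩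
    ∑< d (bit ∘ C) + ∑< d (bit ∘ X) * 2                       ∎
    where
    open ≡-Reasoning
    path : ∀ (j : Fin D) → lookup (ladder X C) (j ↑ˡ d) ≡ railBit X (toℕ j)
    path j rewrite lookup∘tabulate ([ railBit X ∘ toℕ , C ∘ toℕ ]′ ∘ splitAt D) (j ↑ˡ d) | splitAt-↑ˡ D j d = refl
    rungs : ∀ (i : Fin d) → lookup (ladder X C) (D ↑ʳ i) ≡ C (toℕ i)
    rungs i rewrite lookup∘tabulate ([ railBit X ∘ toℕ , C ∘ toℕ ]′ ∘ splitAt D) (D ↑ʳ i) | splitAt-↑ʳ D d i = refl
    right-half : ∀ y → y < d → railBit X (d + y) ≡ X (d ∸ suc y)
    right-half y y<d with d + y <? d
    ... | yes lt = ⊥-elim (<-irrefl refl (<-≤-trans lt (m≤m+n d y)))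
    ... | no _   = cong X (trans (cong (_∸ suc (d + y)) D≡d+d)
                                 (trans (cong (d + d ∸_) (sym (+-suc d y))) ([m+n]∸[m+o]≡n∸o d d (suc y))))
    rails : ∑< D (bit ∘ railBit X) ≡ ∑< d (bit ∘ X) * 2
    rails = begin
      ∑< D (bit ∘ railBit X)                                  ≡⟨ cong (λ n → ∑< n (bit ∘ railBit X)) D≡d+d ⟩
      ∑< (d + d) (bit ∘ railBit X)                            ≡⟨ ∑<-+ d d (bit ∘ railBit X) ⟩
      ∑< d (bit ∘ railBit X) + ∑< d (λ y → bit (railBit X (d + y)))
        ≡⟨ cong₂ _+_ (∑<-cong d λ x x<d → cong bit (railBit-left X x x<d))
                     (trans (∑<-cong d λ y y<d → cong bit (right-half y y<d)) (∑<-reverse d (bit ∘ X))) ⟩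
      ∑< d (bit ∘ X) + ∑< d (bit ∘ X)                         ≡⟨ cong (∑< d (bit ∘ X) +_) (sym (+-identityʳ (∑< d (bit ∘ X)))) ⟩
      2 * ∑< d (bit ∘ X)                                      ≡⟨ *-comm 2 (∑< d (bit ∘ X)) ⟩
      ∑< d (bit ∘ X) * 2                                      ∎

  ladder-degrees : ∀ X C → RailCondition X C → ∀ v → ZeroOrTwo (deg G (ladder X C) v)
  ladder-degrees X C rc = degrees-zeroOrTwo F
    (RailCondition-cong (λ i i<d → sym (pathOn-ladder X C i i<d)) (λ i i<d → sym (rungOn-ladder X C i i<d)) rc)
    (RailCondition-cong (λ i i<d → sym (rightOn-ladder X C i i<d)) (λ i i<d → sym (rungOn-ladder X C i i<d)) rc)
    (subst ZeroOrTwo (sym (cong₂ _+_ (cong bit (pathOn-ladder X C d′ (n<1+n d′)))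
                                     (cong bit (trans (cong (pathOn F) (sym D∸d≡d)) (rightOn-ladder X C d′ (n<1+n d′))))))
                     (zeroOrTwo[b+b] (X d′)))
    where
    F = ladder X C

  inSegment : ℕ → ℕ → ℕ → Bool
  inSegment j l i = ⌊ j ≤? i ⌋ ∧ ⌊ i <? l ⌋

  endRung : ℕ → ℕ → ℕ → Bool
  endRung j l i = ⌊ j ≟ i ⌋ ∨ ⌊ l ≟ i ⌋

  -- the cycle through the rungs j < l and the rail edges between them; for l = d there is
  -- no rung l, and the cycle turns at the middle vertex v_d instead
  segment : ℕ → ℕ → EdgeSet G
  segment j l = ladder (inSegment j l) (endRung j l)

  inSegment-yes : ∀ {j l i} → j ≤ i → i < l → inSegment j l i ≡ true
  inSegment-yes {j} {l} {i} j≤i i<l rewrite ⌊⌋-yes (j ≤? i) j≤i | ⌊⌋-yes (i <? l) i<l = refl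

  inSegment-below : ∀ {j l i} → i < j → inSegment j l i ≡ false
  inSegment-below {j} {l} {i} i<j rewrite ⌊⌋-no (j ≤? i) (<⇒≱ i<j) = refl

  inSegment-above : ∀ {j l i} → l ≤ i → inSegment j l i ≡ false
  inSegment-above {j} {l} {i} l≤i rewrite ⌊⌋-no (i <? l) (≤⇒≯ l≤i) = ∧-zeroʳ _

  inSegment⇒ : ∀ {j l i} → inSegment j l i ≡ true → j ≤ i × i < l
  inSegment⇒ {j} {l} {i} h with j ≤? i | i <? l
  ... | yes j≤i | yes i<l = j≤i , i<l

  endRung-first : ∀ j l → endRung j l j ≡ true
  endRung-first j l rewrite ⌊⌋-yes (j ≟ j) refl = refl

  endRung-last : ∀ j l → endRung j l l ≡ true
  endRung-last j l rewrite ⌊⌋-yes (l ≟ l) refl = ∨-zeroʳ _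

  endRung-off : ∀ {j l i} → i ≢ j → i ≢ l → endRung j l i ≡ false
  endRung-off {j} {l} {i} i≢j i≢l rewrite ⌊⌋-no (j ≟ i) (i≢j ∘ sym) | ⌊⌋-no (l ≟ i) (i≢l ∘ sym) = refl

  endRung⇒ : ∀ {j l i} → endRung j l i ≡ true → j ≡ i ⊎ l ≡ i
  endRung⇒ {j} {l} {i} h with j ≟ i | l ≟ i
  ... | yes j≡i | _       = inj₁ j≡i
  ... | no _    | yes l≡i = inj₂ l≡i

  segment-left : ∀ j l {x} (x<D : x < D) → x < d → lookup (segment j l) (pathEdge x x<D) ≡ true → j ≤ x × x < l
  segment-left j l {x} x<D x<d h =
    inSegment⇒ (trans (sym (trans (lookup-ladder-path (inSegment j l) (endRung j l) x x<D) (railBit-left (inSegment j l) x x<d))) h)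

  segment-right : ∀ j l {i} → i < d → lookup (segment j l) (rightEdge i) ≡ true → j ≤ i × i < l
  segment-right j l {i} i<d h =
    inSegment⇒ (trans (sym (trans (lookup-ladder-path (inSegment j l) (endRung j l) _ (D∸suc<D i)) (railBit-right (inSegment j l) i i<d))) h)

  segment-rung : ∀ j l {i} (i<d : i < d) → lookup (segment j l) (rung i i<d) ≡ true → j ≡ i ⊎ l ≡ i
  segment-rung j l {i} i<d h = endRung⇒ {j} {l} {i} (trans (sym (lookup-ladder-rung (inSegment j l) (endRung j l) i i<d)) h)

  segment-rails : ∀ {j l} → j < l → RailCondition (inSegment j l) (endRung j l)
  segment-rails {j} {l} j<l i _ with <-cmp i j
  segment-rails {j} {l} j<l zero    _ | tri< i<j _ _
    rewrite inSegment-below {j} {l} i<j | endRung-off {j} {l} (<⇒≢ i<j) (<⇒≢ (<-trans i<j j<l)) = inj₁ refl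
  segment-rails {j} {l} j<l (suc i) _ | tri< i<j _ _
    rewrite inSegment-below {j} {l} i<j | inSegment-below {j} {l} (<-trans (n<1+n i) i<j)
          | endRung-off {j} {l} (<⇒≢ i<j) (<⇒≢ (<-trans i<j j<l)) = inj₁ refl
  segment-rails {j} {l} j<l zero    _ | tri≈ _ refl _
    rewrite inSegment-yes {zero} {l} ≤-refl j<l | endRung-first zero l = inj₂ refl
  segment-rails {j} {l} j<l (suc i) _ | tri≈ _ refl _
    rewrite inSegment-yes {suc i} {l} ≤-refl j<l | inSegment-below {suc i} {l} (n<1+n i) | endRung-first (suc i) l = inj₂ refl
  segment-rails {j} {l} j<l (suc i) _ | tri> _ _ j<si with <-cmp (suc i) l
  ... | tri< si<l _ _
    rewrite inSegment-yes {j} {l} (<⇒≤ j<si) si<l | inSegment-yes {j} {l} (≤-pred j<si) (<-trans (n<1+n i) si<l)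
          | endRung-off {j} {l} (>⇒≢ j<si) (<⇒≢ si<l) = inj₂ refl
  ... | tri≈ _ refl _
    rewrite inSegment-above {j} {suc i} {suc i} ≤-refl | inSegment-yes {j} {suc i} (≤-pred j<si) (n<1+n i)
          | endRung-last j (suc i) = inj₂ refl
  ... | tri> _ _ l<si
    rewrite inSegment-above {j} {l} (<⇒≤ l<si) | inSegment-above {j} {l} (≤-pred l<si)
          | endRung-off {j} {l} (>⇒≢ j<si) (>⇒≢ l<si) = inj₁ refl

  segment-isCycle : ∀ {j l} → j < l → l ≤ d → IsCycle G (segment j l)
  segment-isCycle {j} {suc l′} j<l l≤d =
    (root , lookup⇒∈ rung-j) , ladder-degrees X C (segment-rails j<l) , rooted⇒Connected G S root reach
    where
    l = suc l′
    X = inSegment j l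
    C = endRung j l
    S = segment j l
    j<d : j < d
    j<d = <-≤-trans j<l l≤d
    root = rung j j<d
    rung-j : lookup S root ≡ true
    rung-j = trans (lookup-ladder-rung X C j j<d) (endRung-first j l)
    from-left : ∀ x (x<D : x < D) → x < d → j ≤ x → x < l → Path S (pathEdge x x<D) root
    from-left x x<D x<d j≤x x<l =
      left-chain S x x<D j≤x (λ y j≤y y≤x → trans (pathOn-ladder X C y (≤-<-trans y≤x x<d)) (inSegment-yes j≤y (≤-<-trans y≤x x<l)))
      ◅◅ Star-sym G S (rung-left-step S j j<d rung-j (trans (pathOn-ladder X C j j<d) (inSegment-yes ≤-refl j<l)) ◅ ε)
    from-right : ∀ i → i < d → j ≤ i → i < l → Path S (rightEdge i) root
    from-right i i<d j≤i i<l =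
      right-chain S i i<d j≤i (λ y j≤y y≤i → trans (rightOn-ladder X C y (≤-<-trans y≤i i<d)) (inSegment-yes j≤y (≤-<-trans y≤i i<l)))
      ◅◅ Star-sym G S (rung-right-step S j j<d rung-j (trans (rightOn-ladder X C j j<d) (inSegment-yes ≤-refl j<l)) ◅ ε)
    from-rung-l : ∀ (l<d : l < d) → Path S (rung l l<d) root
    from-rung-l l<d =
      sharedEndpoint⇒Step G S (suc l′) (trans (lookup-ladder-rung X C (suc l′) l<d) (endRung-last j (suc l′)))
        (trans (lookup-ladder-path X C l′ _) (trans (railBit-left X l′ (<-trans (n<1+n l′) l<d)) (inSegment-yes j≤l′ (n<1+n l′))))
        (at-rungˡ (suc l′) l<d) (at-pathEdgeʳ l′ (<-trans (<-trans (n<1+n l′) l<d) d<D))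
      ◅ from-left l′ (<-trans (<-trans (n<1+n l′) l<d) d<D) (<-trans (n<1+n l′) l<d) j≤l′ (n<1+n l′)
      where
      j≤l′ : j ≤ l′
      j≤l′ = ≤-pred j<l
    reach : ∀ e → e ∈ S → Path S e root
    reach = ∀-edge _ path-edge rung-edge
      where
      path-edge : ∀ x x<D → pathEdge x x<D ∈ S → Path S (pathEdge x x<D) root
      path-edge x x<D e∈S with left-or-right x x<D
      ... | inj₁ x<d = uncurry (from-left x x<D x<d) (segment-left j l x<D x<d (∈⇒lookup e∈S))
      ... | inj₂ (i , i<d , eq) rewrite eq = uncurry (from-right i i<d) (segment-right j l i<d (∈⇒lookup e∈S))
      rung-edge : ∀ i i<d → rung i i<d ∈ S → Path S (rung i i<d) root
      rung-edge i i<d e∈S with segment-rung j l i<d (∈⇒lookup e∈S)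
      ... | inj₁ refl = ε
      ... | inj₂ refl = from-rung-l i<d

  rung-parity : ∀ {j l} → ∣ segment j l ∣ % 2 ≡ ∑< d (bit ∘ endRung j l) % 2
  rung-parity {j} {l} = trans (cong (_% 2) (∣ladder∣ (inSegment j l) (endRung j l)))
    ([m+kn]%n≡m%n (∑< d (bit ∘ endRung j l)) (∑< d (bit ∘ inSegment j l)) 2)

  segment-odd : ∀ {j} → j < d → ∣ segment j d ∣ % 2 ≡ 1
  segment-odd {j} j<d = trans (rung-parity {j} {d}) (cong (_% 2) (trans
    (∑<-single d (bit ∘ endRung j d) j j<d (λ x x<d x≢j → cong bit (endRung-off x≢j (<⇒≢ x<d))))
    (cong bit (endRung-first j d))))

  segment-even : ∀ {j l} → j < l → l < d → ∣ segment j l ∣ % 2 ≡ 0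
  segment-even {j} {l} j<l l<d = trans (rung-parity {j} {l}) (cong (_% 2) (trans
    (∑<-pair d (bit ∘ endRung j l) j l (<-trans j<l l<d) l<d (<⇒≢ j<l) (λ x _ x≢j x≢l → cong bit (endRung-off x≢j x≢l)))
    (cong₂ _+_ (cong bit (endRung-first j l)) (cong bit (endRung-last j l)))))

  module Rail {X C : ℕ → Bool} (rc : RailCondition X C) where

    rail-before : ∀ j → j ≤ d → (∀ y → y < j → C y ≡ false) → ∀ y → y < j → X y ≡ false
    rail-before j j≤d no-rung zero y<j = zeroOrTwo[b+0+0]⇒b≡false (X 0)
      (subst (λ c → ZeroOrTwo ((bit (X 0) + 0) + bit c)) (no-rung 0 y<j) (rc 0 (<-≤-trans y<j j≤d)))
    rail-before j j≤d no-rung (suc y) y<j = zeroOrTwo[b+0+0]⇒b≡false (X (suc y))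
      (subst₂ (λ b c → ZeroOrTwo ((bit (X (suc y)) + bit b) + bit c))
              (rail-before j j≤d no-rung y (<-trans (n<1+n y) y<j)) (no-rung (suc y) y<j) (rc (suc y) (<-≤-trans y<j j≤d)))

    rail-start : ∀ j → j < d → C j ≡ true → (∀ y → y < j → X y ≡ false) → X j ≡ true
    rail-start zero j<d rung _ = zeroOrTwo[b+0+1]⇒b≡true (X 0)
      (subst (λ c → ZeroOrTwo ((bit (X 0) + 0) + bit c)) rung (rc 0 j<d))
    rail-start (suc j) j<d rung off = zeroOrTwo[b+0+1]⇒b≡true (X (suc j))
      (subst₂ (λ b c → ZeroOrTwo ((bit (X (suc j)) + bit b) + bit c)) (off j (n<1+n j)) rung (rc (suc j) j<d))

    rail-run : ∀ j i → j ≤ i → i < d → X j ≡ true → (∀ y → j < y → y ≤ i → C y ≡ false) → X i ≡ true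
    rail-run j i j≤i i<d on no-rung with j ≟ i
    ... | yes refl = on
    rail-run j zero    j≤0  _   on no-rung | no j≢0  = ⊥-elim (j≢0 (n≤0⇒n≡0 j≤0))
    rail-run j (suc i) j≤si i<d on no-rung | no j≢si = zeroOrTwo[b+1+0]⇒b≡true (X (suc i))
      (subst₂ (λ b c → ZeroOrTwo ((bit (X (suc i)) + bit b) + bit c))
              (rail-run j i (≤-pred j<si) (<-trans (n<1+n i) i<d) on (λ y j<y y≤i → no-rung y j<y (≤-trans y≤i (n≤1+n i))))
              (no-rung (suc i) j<si ≤-refl) (rc (suc i) i<d))
      where
      j<si : j < suc i
      j<si = ≤∧≢⇒< j≤si j≢si

  segment-⊆ : ∀ {F j l} → j < l → l ≤ d →
    (∀ i → j ≤ i → i < l → pathOn F i ≡ true × rightOn F i ≡ true) → rungOn F j ≡ true → (l < d → rungOn F l ≡ true) →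
    segment j l ⊆ F
  segment-⊆ {F} {j} {l} j<l l≤d rails rung-j rung-l {e} e∈S =
    lookup⇒∈ (∀-edge Inherited path-edge rung-edge e (∈⇒lookup e∈S))
    where
    Inherited : Fin (D + d) → Set
    Inherited e = lookup (segment j l) e ≡ true → lookup F e ≡ true
    path-edge : ∀ x x<D → Inherited (pathEdge x x<D)
    path-edge x x<D h with left-or-right x x<D
    ... | inj₁ x<d = trans (sym (pathOn-lookup F x x<D)) (proj₁ (uncurry (rails x) (segment-left j l x<D x<d h)))
    ... | inj₂ (i , i<d , eq) rewrite eq =
      trans (sym (pathOn-lookup F _ (D∸suc<D i))) (proj₂ (uncurry (rails i) (segment-right j l i<d h)))
    rung-edge : ∀ i i<d → Inherited (rung i i<d)
    rung-edge i i<d h with segment-rung j l i<d h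
    ... | inj₁ refl = trans (sym (rungOn-lookup F i i<d)) rung-j
    ... | inj₂ refl = trans (sym (rungOn-lookup F i i<d)) (rung-l i<d)

  left-rails : ∀ {F} → IsCycle G F → RailCondition (pathOn F) (rungOn F)
  left-rails {F} (_ , degF , _) i i<d = subst ZeroOrTwo (deg-left F i i<d) (degF i)

  right-rails : ∀ {F} → IsCycle G F → RailCondition (rightOn F) (rungOn F)
  right-rails {F} (_ , degF , _) i i<d = subst ZeroOrTwo (deg-right F i i<d) (degF (D ∸ i))

  rails-between : ∀ {F} → IsCycle G F → ∀ {j l} → j < d → l ≤ d → rungOn F j ≡ true →
    (∀ y → 0 ≤ y → y < j → rungOn F y ≡ false) → (∀ y → suc j ≤ y → y < l → rungOn F y ≡ false) →
    ∀ i → j ≤ i → i < l → pathOn F i ≡ true × rightOn F i ≡ true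
  rails-between {F} cyc {j} {l} j<d l≤d rung-j before between i j≤i i<l = run (left-rails cyc) , run (right-rails cyc)
    where
    run : ∀ {X} (rc : RailCondition X (rungOn F)) → X i ≡ true
    run rc = Rail.rail-run rc j i j≤i (<-≤-trans i<l l≤d)
               (Rail.rail-start rc j j<d rung-j (Rail.rail-before rc j (<⇒≤ j<d) (λ y y<j → before y z≤n y<j)))
               (λ y j<y y≤i → between y j<y (≤-<-trans y≤i i<l))

  cycle-segment : ∀ {F} → IsCycle G F → ∃[ j ] ∃[ l ] j < l × l ≤ d × F ≡ segment j l
  cycle-segment {F} cyc@((e , e∈F) , degF , _) with first-true (rungOn F) 0 d
  ... | inj₂ no-rung = ⊥-elim (∀-edge (λ e → e ∈ F → ⊥) path-edge rung-edge e e∈F)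
    where
    off : ∀ {b} → b ≡ true → b ≡ false → ⊥
    off refl ()
    path-edge : ∀ x x<D → pathEdge x x<D ∈ F → ⊥
    path-edge x x<D e∈F with left-or-right x x<D
    ... | inj₁ x<d = off (trans (pathOn-lookup F x x<D) (∈⇒lookup e∈F))
                         (Rail.rail-before (left-rails cyc) d ≤-refl (λ y → no-rung y z≤n) x x<d)
    ... | inj₂ (i , i<d , eq) rewrite eq = off (trans (pathOn-lookup F _ (D∸suc<D i)) (∈⇒lookup e∈F))
                                               (Rail.rail-before (right-rails cyc) d ≤-refl (λ y → no-rung y z≤n) i i<d)
    rung-edge : ∀ i i<d → rung i i<d ∈ F → ⊥
    rung-edge i i<d e∈F = off (trans (rungOn-lookup F i i<d) (∈⇒lookup e∈F)) (no-rung i z≤n i<d)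
  ... | inj₁ (j , _ , j<d , rung-j , before) with first-true (rungOn F) (suc j) d
  ...   | inj₂ none = j , d , j<d , ≤-refl ,
            sym (⊆-cycle⇒≡ G (segment-isCycle j<d ≤-refl) cyc
                   (segment-⊆ j<d ≤-refl (rails-between cyc j<d ≤-refl rung-j before none) rung-j (λ d<d → ⊥-elim (<-irrefl refl d<d))))
  ...   | inj₁ (l , j<l , l<d , rung-l , between) = j , l , j<l , <⇒≤ l<d ,
            sym (⊆-cycle⇒≡ G (segment-isCycle j<l (<⇒≤ l<d)) cyc
                   (segment-⊆ j<l (<⇒≤ l<d) (rails-between cyc j<d (<⇒≤ l<d) rung-j before between) rung-j (λ _ → rung-l)))

  endRung-in : ∀ {j l j′ l′} i → i < d → segment j l ≡ segment j′ l′ → endRung j l i ≡ true → j′ ≡ i ⊎ l′ ≡ i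
  endRung-in {j} {l} {j′} {l′} i i<d eq on = segment-rung j′ l′ i<d
    (trans (cong (λ S → lookup S (rung i i<d)) (sym eq)) (trans (lookup-ladder-rung (inSegment j l) (endRung j l) i i<d) on))

  segment-injective-first : ∀ {j j′ l} → j < l → l ≤ d → segment j l ≡ segment j′ l → j ≡ j′
  segment-injective-first {j} {j′} {l} j<l l≤d eq with endRung-in {j} {l} {j′} {l} j (<-≤-trans j<l l≤d) eq (endRung-first j l)
  ... | inj₁ j′≡j = sym j′≡j
  ... | inj₂ refl = ⊥-elim (<-irrefl refl j<l)

  segment-injective : ∀ {j l j′ l′} → j < l → l < d → j′ < l′ → segment j l ≡ segment j′ l′ → (j , l) ≡ (j′ , l′)
  segment-injective {j} {l} {j′} {l′} j<l l<d j′<l′ eq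
    with endRung-in {j} {l} {j′} {l′} j (<-trans j<l l<d) eq (endRung-first j l)
       | endRung-in {j} {l} {j′} {l′} l l<d eq (endRung-last j l)
  ... | inj₁ refl | inj₂ refl = refl
  ... | inj₁ refl | inj₁ refl = ⊥-elim (<-irrefl refl j<l)
  ... | inj₂ refl | inj₂ refl = ⊥-elim (<-irrefl refl j<l)
  ... | inj₂ refl | inj₁ refl = ⊥-elim (<-asym j<l j′<l′)

  count-odd : c-odd≡ G d
  count-odd = subst (c-odd≡ G) (length-upTo d)
    (HasCount-map G (OddCycle G) (λ j → segment j d) (upTo d) (Unique.upTo⁺ d)
      (λ j∈ _ → segment-injective-first (∈-upTo⁻ j∈) ≤-refl)
      (λ j∈ → segment-isCycle (∈-upTo⁻ j∈) ≤-refl , segment-odd (∈-upTo⁻ j∈)) complete)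
    where
    complete : ∀ F → OddCycle G F → ∃[ j ] j ∈L upTo d × F ≡ segment j d
    complete F (cyc , odd) with cycle-segment cyc
    ... | (j , l , j<l , l≤d , refl) with m≤n⇒m<n∨m≡n l≤d
    ...   | inj₁ l<d  = ⊥-elim (0≢1+n (trans (sym (segment-even j<l l<d)) odd))
    ...   | inj₂ refl = j , ∈-upTo⁺ j<l , refl

  count-even : c-even≡ G (length (pairs d))
  count-even = HasCount-map G (EvenCycle G) (uncurry segment) (pairs d) (pairs-unique d)
    (λ p∈ q∈ → segment-injective (proj₁ (∈-pairs⁻ d p∈)) (proj₂ (∈-pairs⁻ d p∈)) (proj₁ (∈-pairs⁻ d q∈))) sound complete
    where
    sound : ∀ {p} → p ∈L pairs d → EvenCycle G (uncurry segment p)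
    sound p∈ = segment-isCycle (proj₁ (∈-pairs⁻ d p∈)) (<⇒≤ (proj₂ (∈-pairs⁻ d p∈))) ,
               segment-even (proj₁ (∈-pairs⁻ d p∈)) (proj₂ (∈-pairs⁻ d p∈))
    complete : ∀ F → EvenCycle G F → ∃[ p ] p ∈L pairs d × F ≡ uncurry segment p
    complete F (cyc , even) with cycle-segment cyc
    ... | (j , l , j<l , l≤d , refl) with m≤n⇒m<n∨m≡n l≤d
    ...   | inj₁ l<d  = (j , l) , ∈-pairs⁺ d j<l l<d , refl
    ...   | inj₂ refl = ⊥-elim (0≢1+n (trans (sym even) (segment-odd j<l)))

-- Comparing the counts

n*n≤2^n : ∀ n → 4 ≤ n → n * n ≤ 2 ^ n
n*n≤2^n n 4≤n = subst (λ m → m * m ≤ 2 ^ m) (m∸n+n≡m 4≤n) (go (n ∸ 4))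
  where
  open ≤-Reasoning
  go : ∀ t → (t + 4) * (t + 4) ≤ 2 ^ (t + 4)
  go zero    = ≤-refl
  go (suc t) = begin
    suc m * suc m        ≡⟨ suc-square m ⟩
    m * m + (m + m + 1)  ≤⟨ +-monoʳ-≤ (m * m) (≤-trans (+-monoʳ-≤ (m + m) 1≤m) (≤-reflexive (3m m))) ⟩
    m * m + 3 * m        ≤⟨ +-monoʳ-≤ (m * m) (*-monoˡ-≤ m (≤-trans (s≤s (s≤s (s≤s z≤n))) (m≤n+m 4 t))) ⟩
    m * m + m * m        ≤⟨ +-mono-≤ (go t) (go t) ⟩
    2 ^ m + 2 ^ m        ≡⟨ cong (2 ^ m +_) (sym (+-identityʳ (2 ^ m))) ⟩
    2 ^ suc m            ∎
    where
    m = t + 4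
    1≤m : 1 ≤ m
    1≤m = ≤-trans (s≤s z≤n) (m≤n+m 4 t)
    3m : ∀ m → m + m + m ≡ 3 * m
    3m = solve-∀

M*k<2^k : ∀ M k → M + 4 ≤ k → M * k < 2 ^ k
M*k<2^k M k M+4≤k = <-≤-trans (*-monoˡ-< k ⦃ >-nonZero (<-≤-trans (s≤s z≤n) 4≤k) ⦄ M<k) (n*n≤2^n k 4≤k)
  where
  M<k : M < k
  M<k = <-≤-trans (m<m+n M (s≤s z≤n)) M+4≤k
  4≤k : 4 ≤ k
  4≤k = ≤-trans (m≤n+m 4 M) M+4≤k

M*d<∣pairs∣ : ∀ M d → 2 * M + 2 ≤ d → M * d < length (pairs d)
M*d<∣pairs∣ M d K≤d = *-cancelˡ-< 2 (M * d) P (+-cancelʳ-< d (2 * (M * d)) (2 * P) (begin-strict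
  2 * (M * d) + d          <⟨ m<m+n _ (<-≤-trans (s≤s z≤n) (≤-trans (m≤n+m 2 (2 * M)) K≤d)) ⟩
  2 * (M * d) + d + d      ≡⟨ expand M d ⟩
  (2 * M + 2) * d          ≤⟨ *-monoˡ-≤ d K≤d ⟩
  d * d                    ≡⟨ sym (2*∣pairs∣+n≡n*n d) ⟩
  2 * P + d                ∎))
  where
  open ≤-Reasoning
  P = length (pairs d)
  expand : ∀ M d → 2 * (M * d) + d + d ≡ (2 * M + 2) * d
  expand = solve-∀

proposition2p1 :
    (∀ (M : ℕ) → ∃[ K ] ∀ (k : ℕ) → 3 ≤ k → k % 2 ≡ 1 → K ≤ k →
       ∃[ a ] ∃[ b ] (c-odd≡ (R k) a × c-even≡ (R k) b × 0 < b × M * b < a))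
    × (∀ (M : ℕ) → ∃[ K ] ∀ (d : ℕ) → 1 ≤ d → K ≤ d →
       ∃[ a ] ∃[ b ] (c-even≡ (L d) a × c-odd≡ (L d) b × 0 < b × M * b < a))
proposition2p1 = (λ M → M + 4 , ring M) , (λ M → 2 * M + 2 , ladder M)
  where
  ring : ∀ M k → 3 ≤ k → k % 2 ≡ 1 → M + 4 ≤ k →
    ∃[ a ] ∃[ b ] (c-odd≡ (R k) a × c-even≡ (R k) b × 0 < b × M * b < a)
  ring M (suc zero) (s≤s ()) _ _
  ring M (suc (suc n)) _ k-odd K≤k =
    2 ^ k , k , count-odd k-odd , count-even k-odd , s≤s z≤n , M*k<2^k M k K≤k
    where open RingOfSquares n using (k; count-odd; count-even)
  ladder : ∀ M d → 1 ≤ d → 2 * M + 2 ≤ d →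
    ∃[ a ] ∃[ b ] (c-even≡ (L d) a × c-odd≡ (L d) b × 0 < b × M * b < a)
  ladder M (suc d′) _ K≤d =
    length (pairs d) , d , count-even , count-odd , s≤s z≤n , M*d<∣pairs∣ M d K≤d
    where open Ladder d′ using (d; count-odd; count-even)
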